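{- Let $a,b$ be parameters with $b\neq0$, and let $y$ be a further parameter. Let $L=\left(\frac{1+(2-a+y)x+(-a+b+1+y)x^2}{1+ax+bx^2},\frac{x}{1+ax+bx^2}\right)$ and let $\mu_n(y)$ be the $(n,0)$ entry of $L^{ -1}$. Writing $\mu_n(y)=\sum_k m_{n,k}y^k$, the matrix $(m_{n,k})_{n,k\ge0}$ equals the Riordan array $(g(x),f(x))$, where, with $S=\sqrt{1-2ax+(a^2-4b)x^2}$ (the power series with constant term $1$), $$g(x)=\frac{2b}{1-a+2b+(a-1)(a-4b)x+(a-1)S},\qquad f(x)=\frac{S+(a-2b)x-1}{1-a+2b+(a-1)(a-4b)x+(a-1)S},$$ and $(g(x),f(x))$ is a Riordan involution. -}

module Defs where

open import Data.Nat as ℕ using (ℕ; zero; suc; _∸_)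
open import Data.Rational as ℚ using (ℚ; 0ℚ; 1ℚ)
open import Relation.Nullary using (yes; no)

module Series {A : Set} (0# 1# : A) (_+_ _*_ : A → A → A) (-_ : A → A) where

  PS : Set
  PS = ℕ → A

  sumTo : (ℕ → A) → ℕ → A
  sumTo f zero    = 0#
  sumTo f (suc n) = sumTo f n + f n

  const : A → PS
  const c zero    = c
  const c (suc _) = 0#

  X : PS
  X 1 = 1#
  X _ = 0#

  _⊕_ : PS → PS → PS
  (s ⊕ t) n = s n + t n

  ⊖_ : PS → PS
  (⊖ s) n = - (s n)

  _·_ : A → PS → PS
  (c · s) n = c * s n

  _⊛_ : PS → PS → PS
  (s ⊛ t) n = sumTo (λ i → s i * t (n ∸ i)) (suc n)

  _^_ : PS → ℕ → PS
  s ^ zero  = const 1#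
  s ^ suc k = s ⊛ (s ^ k)

  riordan : PS → PS → ℕ → ℕ → A
  riordan g f n k = (g ⊛ (f ^ k)) n

  -- Product of a lower-triangular infinite matrix P with a matrix Q:
  -- (P Q)(n,k) = Σ_{j ≤ n} P(n,j) Q(j,k).
  lowerMul : (ℕ → ℕ → A) → (ℕ → ℕ → A) → ℕ → ℕ → A
  lowerMul P Q n k = sumTo (λ j → P n j * Q j k) (suc n)

  δ : ℕ → ℕ → A
  δ n k with n ℕ.≟ k
  ... | yes _ = 1#
  ... | no  _ = 0#

-- ℚ[[x]] (used both for series in x over ℚ and for series in y over ℚ)

module QS = Series 0ℚ 1ℚ ℚ._+_ ℚ._*_ ℚ.-_

-- (ℚ[[y]])[[x]] : series in x whose coefficients are series in y.
-- The entries of L and L⁻¹ are polynomials in y, viewed inside ℚ[[y]].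
module XY = Series (QS.const 0ℚ) (QS.const 1ℚ) QS._⊕_ QS._⊛_ QS.⊖_

_≐_ : QS.PS → QS.PS → Set
s ≐ t = ∀ n → s n ≡ t n
  where open import Relation.Binary.PropositionalEquality using (_≡_)

_≐₂_ : XY.PS → XY.PS → Set
s ≐₂ t = ∀ n k → s n k ≡ t n k
  where open import Relation.Binary.PropositionalEquality using (_≡_)

2ℚ 4ℚ : ℚ
2ℚ = 1ℚ ℚ.+ 1ℚ
4ℚ = 2ℚ ℚ.+ 2ℚ

yvar : QS.PS
yvar = QS.X

numL : ℚ → ℚ → XY.PS
numL a b 0 = QS.const 1ℚ
numL a b 1 = QS.const (2ℚ ℚ.- a) QS.⊕ yvar
numL a b 2 = QS.const (ℚ.- a ℚ.+ b ℚ.+ 1ℚ) QS.⊕ yvar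
numL a b _ = QS.const 0ℚ

denL : ℚ → ℚ → XY.PS
denL a b 0 = QS.const 1ℚ
denL a b 1 = QS.const a
denL a b 2 = QS.const b
denL a b _ = QS.const 0ℚ

xL : XY.PS
xL = XY.X

radicand : ℚ → ℚ → QS.PS
radicand a b 0 = 1ℚ
radicand a b 1 = ℚ.- (2ℚ ℚ.* a)
radicand a b 2 = a ℚ.* a ℚ.- 4ℚ ℚ.* b
radicand a b _ = 0ℚ

denG : ℚ → ℚ → QS.PS → QS.PS
denG a b S = (QS.const (1ℚ ℚ.- a ℚ.+ 2ℚ ℚ.* b)
               QS.⊕ (((a ℚ.- 1ℚ) ℚ.* (a ℚ.- 4ℚ ℚ.* b)) QS.· QS.X))
               QS.⊕ ((a ℚ.- 1ℚ) QS.· S)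

numF : ℚ → ℚ → QS.PS → QS.PS
numF a b S = (S QS.⊕ ((a ℚ.- 2ℚ ℚ.* b) QS.· QS.X)) QS.⊕ QS.const (ℚ.- 1ℚ)

module Submission where

-- The engine is substitution
-- v ↦ v(F) of a series with F(0) = 0 (PowerSeries.Substitution): a ring
-- morphism with x ↦ F, through which a Riordan array acts on a column by
-- (B, F)·v = B·v(F).  Over ℚ (RationalSeries) a series with nonzero
-- constant term is cancellable, so square roots with given constant term
-- are unique.
--
-- RiordanPair substitutes into the equations S² = rad, g denG = 2b,
-- f denG = numF.  Into F₀ = x/D: S(F₀) = (1 - b x²)/D, whence G₀ g(F₀) = 1
-- and G₀ f(F₀) + H = 0 for the first component G = G₀ + y H of L.  Into f: the
-- relation between x and f is symmetric, whence f(f) = x and g g(f) = 1,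
-- i.e. (g, f) is an involution.  ArrayL reads L through its y-slices, so
-- L times the row generating functions of (g, f) is the first unit vector;
-- as L is lower triangular with unit diagonal, this pins down the first
-- column of L⁻¹ (Bivariate.triangular-unique).

open import Level using (0ℓ)
open import Algebra.Bundles using (CommutativeRing)
open import Data.Rational using (ℚ; 0ℚ; 1ℚ)
open import Relation.Binary.PropositionalEquality using (_≡_; _≢_)

module PowerSeries (R : CommutativeRing 0ℓ 0ℓ) where
  open import Data.Nat as ℕ using (ℕ; zero; suc; _∸_; _≤_; _<_; z≤n; s≤s)
  import Data.Nat.Properties as ℕP
  open import Data.Product using (_,_)
  open import Relation.Binary.PropositionalEquality as P using (_≡_; _≢_)
  open import Relation.Binary.Structures using (IsEquivalence)
  open import Relation.Nullary using (yes; no)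
  open import Data.Empty using (⊥-elim)
  open import Defs using (module Series)

  open CommutativeRing R renaming (Carrier to A) hiding (zero)
  open Series 0# 1# _+_ _*_ -_ public
  open import Relation.Binary.Reasoning.Setoid setoid
  open import Algebra.Properties.Ring ring using (-0#≈0#)
  open import Algebra.Properties.AbelianGroup +-abelianGroup using (⁻¹-∙-comm)

  infix 4 _≋_
  _≋_ : PS → PS → Set
  s ≋ t = ∀ n → s n ≈ t n

  tail : PS → PS
  tail s n = s (suc n)

  +-interchange : ∀ a b c d → (a + b) + (c + d) ≈ (a + c) + (b + d)
  +-interchange a b c d = begin
    (a + b) + (c + d) ≈⟨ +-assoc a b (c + d) ⟩
    a + (b + (c + d)) ≈⟨ +-congˡ (sym (+-assoc b c d)) ⟩
    a + ((b + c) + d) ≈⟨ +-congˡ (+-congʳ (+-comm b c)) ⟩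
    a + ((c + b) + d) ≈⟨ +-congˡ (+-assoc c b d) ⟩
    a + (c + (b + d)) ≈⟨ sym (+-assoc a c (b + d)) ⟩
    (a + c) + (b + d) ∎

  sum-cong : ∀ {f g} n → (∀ i → i < n → f i ≈ g i) → sumTo f n ≈ sumTo g n
  sum-cong zero h = refl
  sum-cong (suc n) h =
    +-cong (sum-cong n (λ i i<n → h i (ℕP.m<n⇒m<1+n i<n))) (h n (ℕP.n<1+n n))

  sum-cong′ : ∀ {f g} n → (∀ i → f i ≈ g i) → sumTo f n ≈ sumTo g n
  sum-cong′ n h = sum-cong n (λ i _ → h i)

  sum-+ : ∀ f g n → sumTo (λ i → f i + g i) n ≈ sumTo f n + sumTo g n
  sum-+ f g zero = sym (+-identityˡ 0#)
  sum-+ f g (suc n) = trans (+-congʳ (sum-+ f g n)) (+-interchange _ _ _ _)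

  sum-*ˡ : ∀ c f n → c * sumTo f n ≈ sumTo (λ i → c * f i) n
  sum-*ˡ c f zero = zeroʳ c
  sum-*ˡ c f (suc n) = trans (distribˡ c (sumTo f n) (f n)) (+-congʳ (sum-*ˡ c f n))

  sum-neg : ∀ f n → sumTo (λ i → - f i) n ≈ - sumTo f n
  sum-neg f zero = sym -0#≈0#
  sum-neg f (suc n) = trans (+-congʳ (sum-neg f n)) (⁻¹-∙-comm (sumTo f n) (f n))

  sum-zero : ∀ {f} n → (∀ i → i < n → f i ≈ 0#) → sumTo f n ≈ 0#
  sum-zero zero h = refl
  sum-zero (suc n) h =
    trans (+-cong (sum-zero n (λ i i<n → h i (ℕP.m<n⇒m<1+n i<n))) (h n (ℕP.n<1+n n)))
          (+-identityˡ 0#)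

  sum-head : ∀ f n → sumTo f (suc n) ≈ f 0 + sumTo (λ i → f (suc i)) n
  sum-head f zero = trans (+-identityˡ (f 0)) (sym (+-identityʳ (f 0)))
  sum-head f (suc n) = trans (+-congʳ (sum-head f n)) (+-assoc _ _ _)

  ≋-refl : ∀ {s} → s ≋ s
  ≋-refl n = refl

  ≋-sym : ∀ {s t} → s ≋ t → t ≋ s
  ≋-sym h n = sym (h n)

  ≋-trans : ∀ {s t u} → s ≋ t → t ≋ u → s ≋ u
  ≋-trans h k n = trans (h n) (k n)

  ⊛-cong : ∀ {s s′ t t′} → s ≋ s′ → t ≋ t′ → s ⊛ t ≋ s′ ⊛ t′
  ⊛-cong hs ht n = sum-cong′ (suc n) (λ i → *-cong (hs i) (ht (n ∸ i)))

  ⊛-0 : ∀ s t → (s ⊛ t) 0 ≈ s 0 * t 0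
  ⊛-0 s t = +-identityˡ _

  ⊛-suc : ∀ s t n → (s ⊛ t) (suc n) ≈ s 0 * t (suc n) + (tail s ⊛ t) n
  ⊛-suc s t n = sum-head (λ i → s i * t (suc n ∸ i)) (suc n)

  ⊛-suc′ : ∀ s t n → (s ⊛ t) (suc n) ≈ (s ⊛ tail t) n + s (suc n) * t 0
  ⊛-suc′ s t n = +-cong (sum-cong (suc n) shift) (*-congˡ (reflexive (P.cong t (ℕP.n∸n≡0 n))))
    where
    shift : ∀ i → i < suc n → s i * t (suc n ∸ i) ≈ s i * tail t (n ∸ i)
    shift i (s≤s i≤n) = *-congˡ (reflexive (P.cong t (ℕP.+-∸-assoc 1 i≤n)))

  ⊛-comm : ∀ s t → s ⊛ t ≋ t ⊛ s
  ⊛-comm s t zero = trans (⊛-0 s t) (trans (*-comm _ _) (sym (⊛-0 t s)))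
  ⊛-comm s t (suc n) = begin
    (s ⊛ t) (suc n)                  ≈⟨ ⊛-suc s t n ⟩
    s 0 * t (suc n) + (tail s ⊛ t) n ≈⟨ +-cong (*-comm _ _) (⊛-comm (tail s) t n) ⟩
    t (suc n) * s 0 + (t ⊛ tail s) n ≈⟨ +-comm _ _ ⟩
    (t ⊛ tail s) n + t (suc n) * s 0 ≈⟨ sym (⊛-suc′ t s n) ⟩
    (t ⊛ s) (suc n)                  ∎

  ⊛-distribʳ : ∀ s t u → (s ⊕ t) ⊛ u ≋ (s ⊛ u) ⊕ (t ⊛ u)
  ⊛-distribʳ s t u n = trans (sum-cong′ (suc n) (λ i → distribʳ _ _ _)) (sum-+ _ _ (suc n))

  ⊛-distribˡ : ∀ s t u → u ⊛ (s ⊕ t) ≋ (u ⊛ s) ⊕ (u ⊛ t)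
  ⊛-distribˡ s t u n = begin
    (u ⊛ (s ⊕ t)) n       ≈⟨ ⊛-comm u (s ⊕ t) n ⟩
    ((s ⊕ t) ⊛ u) n       ≈⟨ ⊛-distribʳ s t u n ⟩
    (s ⊛ u) n + (t ⊛ u) n ≈⟨ +-cong (⊛-comm s u n) (⊛-comm t u n) ⟩
    (u ⊛ s) n + (u ⊛ t) n ∎

  ·-⊛ : ∀ c s t → (c · s) ⊛ t ≋ c · (s ⊛ t)
  ·-⊛ c s t n = trans (sum-cong′ (suc n) (λ i → *-assoc _ _ _)) (sym (sum-*ˡ c _ (suc n)))

  tail-⊛ : ∀ s t → tail (s ⊛ t) ≋ (s 0 · tail t) ⊕ (tail s ⊛ t)
  tail-⊛ s t n = ⊛-suc s t n

  ⊛-assoc : ∀ s t u → (s ⊛ t) ⊛ u ≋ s ⊛ (t ⊛ u)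
  ⊛-assoc s t u zero = begin
    ((s ⊛ t) ⊛ u) 0   ≈⟨ trans (⊛-0 (s ⊛ t) u) (*-congʳ (⊛-0 s t)) ⟩
    (s 0 * t 0) * u 0 ≈⟨ *-assoc _ _ _ ⟩
    s 0 * (t 0 * u 0) ≈⟨ sym (trans (⊛-0 s (t ⊛ u)) (*-congˡ (⊛-0 t u))) ⟩
    (s ⊛ (t ⊛ u)) 0   ∎
  ⊛-assoc s t u (suc n) = begin
    ((s ⊛ t) ⊛ u) (suc n)
      ≈⟨ ⊛-suc (s ⊛ t) u n ⟩
    (s ⊛ t) 0 * u (suc n) + (tail (s ⊛ t) ⊛ u) n
      ≈⟨ +-cong (*-congʳ (⊛-0 s t)) (⊛-cong {t = u} (tail-⊛ s t) ≋-refl n) ⟩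
    (s 0 * t 0) * u (suc n) + (((s 0 · tail t) ⊕ (tail s ⊛ t)) ⊛ u) n
      ≈⟨ +-cong (*-assoc _ _ _) (⊛-distribʳ _ _ u n) ⟩
    s 0 * (t 0 * u (suc n)) + (((s 0 · tail t) ⊛ u) n + ((tail s ⊛ t) ⊛ u) n)
      ≈⟨ +-congˡ (+-cong (·-⊛ (s 0) (tail t) u n) (⊛-assoc (tail s) t u n)) ⟩
    s 0 * (t 0 * u (suc n)) + (s 0 * (tail t ⊛ u) n + (tail s ⊛ (t ⊛ u)) n)
      ≈⟨ sym (+-assoc _ _ _) ⟩
    (s 0 * (t 0 * u (suc n)) + s 0 * (tail t ⊛ u) n) + (tail s ⊛ (t ⊛ u)) n
      ≈⟨ +-congʳ (trans (sym (distribˡ _ _ _)) (*-congˡ (sym (⊛-suc t u n)))) ⟩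
    s 0 * (t ⊛ u) (suc n) + (tail s ⊛ (t ⊛ u)) n
      ≈⟨ sym (⊛-suc s (t ⊛ u) n) ⟩
    (s ⊛ (t ⊛ u)) (suc n) ∎

  const-⊛ : ∀ c s → const c ⊛ s ≋ c · s
  const-⊛ c s n = begin
    (const c ⊛ s) n                               ≈⟨ sum-head _ n ⟩
    c * s n + sumTo (λ i → 0# * s (n ∸ suc i)) n ≈⟨ +-congˡ (sum-zero n (λ i _ → zeroˡ _)) ⟩
    c * s n + 0#                                  ≈⟨ +-identityʳ _ ⟩
    c * s n                                       ∎

  const1-⊛ : ∀ s → const 1# ⊛ s ≋ s
  const1-⊛ s n = trans (const-⊛ 1# s n) (*-identityˡ (s n))

  open import Algebra.Structures _≋_
    using (IsCommutativeRing; IsAbelianGroup; IsMagma)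

  private
    ≋-isEquivalence : IsEquivalence _≋_
    ≋-isEquivalence = record { refl = ≋-refl ; sym = ≋-sym ; trans = ≋-trans }

    ⊕-isAbelianGroup : IsAbelianGroup _⊕_ (const 0#) ⊖_
    ⊕-isAbelianGroup = record
      { isGroup = record
        { isMonoid = record
          { isSemigroup = record
            { isMagma = record { isEquivalence = ≋-isEquivalence
                               ; ∙-cong = λ h k n → +-cong (h n) (k n) }
            ; assoc = λ s t u n → +-assoc _ _ _ }
          ; identity = identityˡ , identityʳ }
        ; inverse = inverseˡ , inverseʳ
        ; ⁻¹-cong = λ h n → -‿cong (h n) }
      ; comm = λ s t n → +-comm _ _ }
      where
      identityˡ : ∀ s n → const 0# n + s n ≈ s n
      identityˡ s zero    = +-identityˡ _
      identityˡ s (suc n) = +-identityˡ _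
      identityʳ : ∀ s n → s n + const 0# n ≈ s n
      identityʳ s zero    = +-identityʳ _
      identityʳ s (suc n) = +-identityʳ _
      inverseˡ : ∀ s n → (- s n) + s n ≈ const 0# n
      inverseˡ s zero    = -‿inverseˡ _
      inverseˡ s (suc n) = -‿inverseˡ _
      inverseʳ : ∀ s n → s n + (- s n) ≈ const 0# n
      inverseʳ s zero    = -‿inverseʳ _
      inverseʳ s (suc n) = -‿inverseʳ _

  psRing : CommutativeRing 0ℓ 0ℓ
  psRing = record
    { isCommutativeRing = record
      { isRing = record
        { +-isAbelianGroup = ⊕-isAbelianGroup
        ; *-cong = ⊛-cong
        ; *-assoc = ⊛-assoc
        ; *-identity = const1-⊛ , (λ s → ≋-trans (⊛-comm s (const 1#)) (const1-⊛ s))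
        ; distrib = (λ u s t → ⊛-distribˡ s t u) , (λ u s t → ⊛-distribʳ s t u) }
      ; *-comm = ⊛-comm } }

  module PSR = CommutativeRing psRing

  const-cong : ∀ {c d} → c ≈ d → const c ≋ const d
  const-cong h zero    = h
  const-cong h (suc n) = refl

  const-+ : ∀ c d → const (c + d) ≋ const c ⊕ const d
  const-+ c d zero    = refl
  const-+ c d (suc n) = sym (+-identityˡ 0#)

  const-* : ∀ c d → const c ⊛ const d ≋ const (c * d)
  const-* c d n = trans (const-⊛ c (const d) n) (scale n)
    where
    scale : ∀ n → c * const d n ≈ const (c * d) n
    scale zero    = refl
    scale (suc n) = zeroʳ c

  const-neg : ∀ c → ⊖ const c ≋ const (- c)
  const-neg c zero    = refl
  const-neg c (suc n) = -0#≈0#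

  ·-as-const : ∀ c s → c · s ≋ const c ⊛ s
  ·-as-const c s = ≋-sym (const-⊛ c s)

  ·-⊛ʳ : ∀ c s t → s ⊛ (c · t) ≋ c · (s ⊛ t)
  ·-⊛ʳ c s t n = trans (⊛-comm s (c · t) n)
                   (trans (·-⊛ c t s n) (*-congˡ (⊛-comm t s n)))

  X-⊛-0 : ∀ s → (X ⊛ s) 0 ≈ 0#
  X-⊛-0 s = trans (⊛-0 X s) (zeroˡ _)

  X-⊛-suc : ∀ s n → (X ⊛ s) (suc n) ≈ s n
  X-⊛-suc s n = begin
    (X ⊛ s) (suc n)                  ≈⟨ ⊛-suc X s n ⟩
    0# * s (suc n) + (tail X ⊛ s) n  ≈⟨ +-cong (zeroˡ _) (⊛-cong {t = s} tailX ≋-refl n) ⟩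
    0# + (const 1# ⊛ s) n            ≈⟨ trans (+-identityˡ _) (const1-⊛ s n) ⟩
    s n                              ∎
    where
    tailX : tail X ≋ const 1#
    tailX zero    = refl
    tailX (suc n) = refl

  ^-cong : ∀ {s t} k → s ≋ t → s ^ k ≋ t ^ k
  ^-cong zero    h = ≋-refl
  ^-cong (suc k) h = ⊛-cong h (^-cong k h)

  δ-diag : ∀ n → δ n n ≈ 1#
  δ-diag n with n ℕ.≟ n
  ... | yes _ = refl
  ... | no ¬p = ⊥-elim (¬p P.refl)

  δ-off : ∀ n k → n ≢ k → δ n k ≈ 0#
  δ-off n k n≢k with n ℕ.≟ k
  ... | yes p = ⊥-elim (n≢k p)
  ... | no _  = refl

  δ-suc : ∀ n k → δ n k ≈ δ (suc n) (suc k)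
  δ-suc n k with n ℕ.≟ k
  ... | yes P.refl = sym (δ-diag (suc n))
  ... | no n≢k     = sym (δ-off (suc n) (suc k) (λ e → n≢k (ℕP.suc-injective e)))

  X^-coeff : ∀ k n → (X ^ k) n ≈ δ n k
  X^-coeff zero    zero    = sym (δ-diag 0)
  X^-coeff zero    (suc n) = sym (δ-off (suc n) 0 (λ ()))
  X^-coeff (suc k) zero    = trans (X-⊛-0 (X ^ k)) (sym (δ-off 0 (suc k) (λ ())))
  X^-coeff (suc k) (suc n) = trans (X-⊛-suc (X ^ k) n) (trans (X^-coeff k n) (δ-suc n k))

  module Sums = Series (const 0#) (const 1#) _⊕_ _⊛_ ⊖_

  sum-coeff : ∀ h N m → Sums.sumTo h N m ≈ sumTo (λ i → h i m) N
  sum-coeff h zero    zero    = refl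
  sum-coeff h zero    (suc m) = refl
  sum-coeff h (suc N) m       = +-congʳ (sum-coeff h N m)

  infix 4 _≈[_]_
  _≈[_]_ : PS → ℕ → PS → Set
  s ≈[ n ] t = ∀ m → m ≤ n → s m ≈ t m

  ≋⇒≈[] : ∀ {s t} n → s ≋ t → s ≈[ n ] t
  ≋⇒≈[] n h m _ = h m

  ≈[]-trans : ∀ {s t u} n → s ≈[ n ] t → t ≈[ n ] u → s ≈[ n ] u
  ≈[]-trans n h k m m≤n = trans (h m m≤n) (k m m≤n)

  ≈[]-sym : ∀ {s t} n → s ≈[ n ] t → t ≈[ n ] s
  ≈[]-sym n h m m≤n = sym (h m m≤n)

  ⊕-≈[] : ∀ {s s′ t t′} n → s ≈[ n ] s′ → t ≈[ n ] t′ → (s ⊕ t) ≈[ n ] (s′ ⊕ t′)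
  ⊕-≈[] n hs ht m m≤n = +-cong (hs m m≤n) (ht m m≤n)

  ⊛-≈[] : ∀ {s s′ t t′} n → s ≈[ n ] s′ → t ≈[ n ] t′ → (s ⊛ t) ≈[ n ] (s′ ⊛ t′)
  ⊛-≈[] n hs ht m m≤n = sum-cong (suc m) λ { i (s≤s i≤m) →
    *-cong (hs i (ℕP.≤-trans i≤m m≤n)) (ht (m ∸ i) (ℕP.≤-trans (ℕP.m∸n≤m m i) m≤n)) }

  pw : A → ℕ → A
  pw c zero    = 1#
  pw c (suc k) = c * pw c k

  -- compose v is defined coefficientwise through the Horner truncations
  --   horner n v = v₀ + F (v₁ + F (v₂ + ... + F vₙ)),
  -- whose coefficients up to n are already final.

  module Substitution (F : PS) (F0 : F 0 ≈ 0#) where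

    F⊛-0 : ∀ s → (F ⊛ s) 0 ≈ 0#
    F⊛-0 s = trans (⊛-0 F s) (trans (*-congʳ F0) (zeroˡ _))

    F⊛-≈[] : ∀ {s t} n → s ≈[ n ] t → (F ⊛ s) ≈[ suc n ] (F ⊛ t)
    F⊛-≈[] {s} {t} n h zero    _         = trans (F⊛-0 s) (sym (F⊛-0 t))
    F⊛-≈[] {s} {t} n h (suc m) (s≤s m≤n) = begin
      (F ⊛ s) (suc m)                  ≈⟨ ⊛-suc F s m ⟩
      F 0 * s (suc m) + (tail F ⊛ s) m ≈⟨ +-cong (trans (*-congʳ F0) (zeroˡ _)) tails ⟩
      0# + (tail F ⊛ t) m              ≈⟨ +-congʳ (sym (trans (*-congʳ F0) (zeroˡ _))) ⟩
      F 0 * t (suc m) + (tail F ⊛ t) m ≈⟨ sym (⊛-suc F t m) ⟩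
      (F ⊛ t) (suc m)                  ∎
      where
      tails : (tail F ⊛ s) m ≈ (tail F ⊛ t) m
      tails = sum-cong (suc m) λ { i (s≤s i≤m) →
        *-congˡ (h (m ∸ i) (ℕP.≤-trans (ℕP.m∸n≤m m i) m≤n)) }

    horner : ℕ → PS → PS
    horner zero    v = const (v 0)
    horner (suc n) v = const (v 0) ⊕ (F ⊛ horner n (tail v))

    compose : PS → PS
    compose v m = horner m v m

    horner-cong : ∀ n {v w} → v ≋ w → horner n v ≋ horner n w
    horner-cong zero    h = const-cong (h 0)
    horner-cong (suc n) h m =
      +-cong (const-cong (h 0) m) (⊛-cong ≋-refl (horner-cong n (λ k → h (suc k))) m)

    horner-step : ∀ n v → horner n v ≈[ n ] horner (suc n) v
    horner-step zero    v zero _ =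
      sym (trans (+-congˡ (F⊛-0 (horner 0 (tail v)))) (+-identityʳ _))
    horner-step (suc n) v m m≤ = +-congˡ (F⊛-≈[] n (horner-step n (tail v)) m m≤)

    horner-stable : ∀ {n} N v → n ≤ N → horner n v ≈[ n ] horner N v
    horner-stable {n} N v n≤N = P.subst (λ K → horner n v ≈[ n ] horner K v)
                                        (ℕP.m∸n+n≡m n≤N) (go (N ∸ n))
      where
      go : ∀ k → horner n v ≈[ n ] horner (k ℕ.+ n) v
      go zero    m _   = refl
      go (suc k) m m≤n =
        trans (go k m m≤n) (horner-step (k ℕ.+ n) v m (ℕP.≤-trans m≤n (ℕP.m≤n+m n k)))

    compose-horner : ∀ n v → compose v ≈[ n ] horner n v
    compose-horner n v m m≤n = horner-stable n v m≤n m ℕP.≤-refl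

    compose-cong : ∀ {v w} → v ≋ w → compose v ≋ compose w
    compose-cong h m = horner-cong m h m

    horner-⊕ : ∀ n v w → horner n (v ⊕ w) ≋ horner n v ⊕ horner n w
    horner-⊕ zero    v w = const-+ (v 0) (w 0)
    horner-⊕ (suc n) v w m = begin
      const (v 0 + w 0) m + (F ⊛ horner n (tail (v ⊕ w))) m
        ≈⟨ +-cong (const-+ (v 0) (w 0) m) (⊛-cong ≋-refl (horner-⊕ n (tail v) (tail w)) m) ⟩
      (const (v 0) m + const (w 0) m) + (F ⊛ (horner n (tail v) ⊕ horner n (tail w))) m
        ≈⟨ +-congˡ (⊛-distribˡ (horner n (tail v)) (horner n (tail w)) F m) ⟩
      (const (v 0) m + const (w 0) m)
        + ((F ⊛ horner n (tail v)) m + (F ⊛ horner n (tail w)) m)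
        ≈⟨ +-interchange _ _ _ _ ⟩
      (const (v 0) m + (F ⊛ horner n (tail v)) m)
        + (const (w 0) m + (F ⊛ horner n (tail w)) m) ∎

    horner-· : ∀ n c v → horner n (c · v) ≋ c · horner n v
    horner-· zero    c v zero    = refl
    horner-· zero    c v (suc m) = sym (zeroʳ c)
    horner-· (suc n) c v m = begin
      const (c * v 0) m + (F ⊛ horner n (tail (c · v))) m
        ≈⟨ +-cong (sym (const-* c (v 0) m)) (⊛-cong ≋-refl (horner-· n c (tail v)) m) ⟩
      (const c ⊛ const (v 0)) m + (F ⊛ (c · horner n (tail v))) m
        ≈⟨ +-cong (const-⊛ c (const (v 0)) m) (·-⊛ʳ c F (horner n (tail v)) m) ⟩
      c * const (v 0) m + c * (F ⊛ horner n (tail v)) m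
        ≈⟨ sym (distribˡ c _ _) ⟩
      c * (const (v 0) m + (F ⊛ horner n (tail v)) m) ∎

    horner-const : ∀ n c → horner n (const c) ≋ const c
    horner-const zero    c = ≋-refl
    horner-const (suc n) c m = begin
      const c m + (F ⊛ horner n (tail (const c))) m
        ≈⟨ +-congˡ (⊛-cong ≋-refl (≋-trans (horner-cong n tail-const) (horner-const n 0#)) m) ⟩
      const c m + (F ⊛ const 0#) m
        ≈⟨ +-congˡ (trans (⊛-comm F _ m) (trans (const-⊛ 0# F m) (zeroˡ _))) ⟩
      const c m + 0#
        ≈⟨ +-identityʳ _ ⟩
      const c m ∎
      where
      tail-const : tail (const c) ≋ const 0#
      tail-const zero    = refl
      tail-const (suc m) = refl

    horner-⊛ : ∀ n v w → horner n (v ⊛ w) ≈[ n ] (horner n v ⊛ horner n w)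
    horner-⊛ zero v w zero _ = trans (⊛-0 v w) (sym (⊛-0 (const (v 0)) (const (w 0))))
    horner-⊛ (suc n) v w =
      ≈[]-trans (suc n) (⊕-≈[] (suc n) (≋⇒≈[] (suc n) (const-cong (⊛-0 v w)))
                                       (F⊛-≈[] n inner))
                        (≋⇒≈[] (suc n) regroup)
      where
      open import Algebra.Solver.Ring.NaturalCoefficients.Default PSR.commutativeSemiring
      a  = horner n (tail v)
      b  = horner n (tail w)
      W  = horner (suc n) w
      Z  = (v 0 · b) ⊕ (a ⊛ W)
      inner : horner n (tail (v ⊛ w)) ≈[ n ] Z
      inner = ≈[]-trans n
        (≋⇒≈[] n (≋-trans (horner-cong n (tail-⊛ v w))
                 (≋-trans (horner-⊕ n _ _) (λ m → +-congʳ (horner-· n (v 0) (tail w) m)))))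
        (⊕-≈[] n (λ m _ → refl)
                 (≈[]-trans n (horner-⊛ n (tail v) w)
                              (⊛-≈[] n (λ m _ → refl) (horner-step n w))))
      expand : ∀ C D f a b → (C PSR.* D) PSR.+ (f PSR.* ((C PSR.* b) PSR.+ (a PSR.* (D PSR.+ (f PSR.* b)))))
                               PSR.≈ (C PSR.+ (f PSR.* a)) PSR.* (D PSR.+ (f PSR.* b))
      expand = solve 5 (λ C D f a b → (C :* D) :+ (f :* ((C :* b) :+ (a :* (D :+ (f :* b)))))
                                      := (C :+ (f :* a)) :* (D :+ (f :* b))) PSR.refl
      regroup : (const (v 0 * w 0) ⊕ (F ⊛ Z)) ≋ (horner (suc n) v ⊛ W)
      regroup = ≋-trans {t = (const (v 0) ⊛ const (w 0)) ⊕ (F ⊛ ((const (v 0) ⊛ b) ⊕ (a ⊛ W)))}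
        (PSR.+-cong (≋-sym (const-* (v 0) (w 0)))
                    (⊛-cong {s = F} ≋-refl (PSR.+-cong {u = a ⊛ W} (·-as-const (v 0) b) ≋-refl)))
        (expand (const (v 0)) (const (w 0)) F a b)

    compose-⊛ : ∀ v w → compose (v ⊛ w) ≋ compose v ⊛ compose w
    compose-⊛ v w m = trans (horner-⊛ m v w m ℕP.≤-refl)
      (⊛-≈[] m (≈[]-sym m (compose-horner m v)) (≈[]-sym m (compose-horner m w)) m ℕP.≤-refl)

    compose-⊕ : ∀ v w → compose (v ⊕ w) ≋ compose v ⊕ compose w
    compose-⊕ v w m = horner-⊕ m v w m

    compose-· : ∀ c v → compose (c · v) ≋ c · compose v
    compose-· c v m = horner-· m c v m

    compose-const : ∀ c → compose (const c) ≋ const c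
    compose-const c m = horner-const m c m

    compose-X : compose X ≋ F
    compose-X zero    = sym F0
    compose-X (suc m) = begin
      const 0# (suc m) + (F ⊛ horner m (tail X)) (suc m)
        ≈⟨ +-congˡ (⊛-cong ≋-refl (≋-trans (horner-cong m tailX) (horner-const m 1#)) (suc m)) ⟩
      0# + (F ⊛ const 1#) (suc m)
        ≈⟨ trans (+-identityˡ _) (trans (⊛-comm F _ (suc m)) (const1-⊛ F (suc m))) ⟩
      F (suc m) ∎
      where
      tailX : tail X ≋ const 1#
      tailX zero    = refl
      tailX (suc n) = refl

    compose-^ : ∀ v k → compose (v ^ k) ≋ compose v ^ k
    compose-^ v zero    = compose-const 1#
    compose-^ v (suc k) = ≋-trans (compose-⊛ v (v ^ k)) (⊛-cong ≋-refl (compose-^ v k))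

    horner-act : ∀ N B v n → (B ⊛ horner N v) n ≈ sumTo (λ j → (B ⊛ (F ^ j)) n * v j) (suc N)
    horner-act zero B v n = begin
      (B ⊛ const (v 0)) n     ≈⟨ trans (⊛-comm B _ n) (const-⊛ (v 0) B n) ⟩
      v 0 * B n               ≈⟨ *-comm _ _ ⟩
      B n * v 0               ≈⟨ *-congʳ (sym (trans (⊛-comm B (const 1#) n) (const1-⊛ B n))) ⟩
      (B ⊛ const 1#) n * v 0  ≈⟨ sym (+-identityˡ _) ⟩
      0# + (B ⊛ const 1#) n * v 0 ∎
    horner-act (suc N) B v n = begin
      (B ⊛ (const (v 0) ⊕ (F ⊛ horner N (tail v)))) n
        ≈⟨ ⊛-distribˡ (const (v 0)) (F ⊛ horner N (tail v)) B n ⟩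
      (B ⊛ const (v 0)) n + (B ⊛ (F ⊛ horner N (tail v))) n
        ≈⟨ +-cong (trans (horner-act zero B v n) (+-identityˡ _))
                  (sym (⊛-assoc B F (horner N (tail v)) n)) ⟩
      (B ⊛ const 1#) n * v 0 + ((B ⊛ F) ⊛ horner N (tail v)) n
        ≈⟨ +-congˡ (horner-act N (B ⊛ F) (tail v) n) ⟩
      (B ⊛ const 1#) n * v 0 + sumTo (λ j → ((B ⊛ F) ⊛ (F ^ j)) n * v (suc j)) (suc N)
        ≈⟨ +-congˡ (sum-cong′ (suc N) (λ j → *-congʳ (⊛-assoc B F (F ^ j) n))) ⟩
      (B ⊛ const 1#) n * v 0 + sumTo (λ j → (B ⊛ (F ^ suc j)) n * v (suc j)) (suc N)
        ≈⟨ sym (sum-head _ (suc N)) ⟩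
      sumTo (λ j → (B ⊛ (F ^ j)) n * v j) (suc (suc N)) ∎

    riordan-act : ∀ B v n → sumTo (λ j → (B ⊛ (F ^ j)) n * v j) (suc n) ≈ (B ⊛ compose v) n
    riordan-act B v n =
      sym (trans (⊛-≈[] n (λ m _ → refl) (compose-horner n v) n ℕP.≤-refl) (horner-act n B v n))

    F^-order : ∀ j m → m < j → (F ^ j) m ≈ 0#
    F^-order (suc j) zero    _         = F⊛-0 (F ^ j)
    F^-order (suc j) (suc m) (s≤s m<j) = begin
      (F ⊛ (F ^ j)) (suc m)                        ≈⟨ ⊛-suc F (F ^ j) m ⟩
      F 0 * (F ^ j) (suc m) + (tail F ⊛ (F ^ j)) m ≈⟨ +-cong (trans (*-congʳ F0) (zeroˡ _)) low ⟩
      0# + 0#                                      ≈⟨ +-identityˡ _ ⟩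
      0#                                           ∎
      where
      low : (tail F ⊛ (F ^ j)) m ≈ 0#
      low = sum-zero (suc m) λ { i (s≤s i≤m) →
        trans (*-congˡ (F^-order j (m ∸ i) (ℕP.≤-<-trans (ℕP.m∸n≤m m i) m<j))) (zeroʳ _) }

    riordan-diag : ∀ B n → (B ⊛ (F ^ n)) n ≈ B 0 * pw (F 1) n
    F^-diag : ∀ n → (F ^ n) n ≈ pw (F 1) n
    riordan-diag B n = begin
      (B ⊛ (F ^ n)) n
        ≈⟨ sum-head _ n ⟩
      B 0 * (F ^ n) n + sumTo (λ i → B (suc i) * (F ^ n) (n ∸ suc i)) n
        ≈⟨ +-cong (*-congˡ (F^-diag n)) (sum-zero n λ i i<n →
             trans (*-congˡ (F^-order n _ (ℕP.∸-monoʳ-< {o = 0} (s≤s z≤n) i<n))) (zeroʳ _)) ⟩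
      B 0 * pw (F 1) n + 0#
        ≈⟨ +-identityʳ _ ⟩
      B 0 * pw (F 1) n ∎
    F^-diag zero    = refl
    F^-diag (suc n) = begin
      (F ⊛ (F ^ n)) (suc n)                        ≈⟨ ⊛-suc F (F ^ n) n ⟩
      F 0 * (F ^ n) (suc n) + (tail F ⊛ (F ^ n)) n ≈⟨ +-cong (trans (*-congʳ F0) (zeroˡ _))
                                                              (riordan-diag (tail F) n) ⟩
      0# + F 1 * pw (F 1) n                        ≈⟨ +-identityˡ _ ⟩
      F 1 * pw (F 1) n                             ∎

-- QF is the library above at R = ℚ; its operations
-- are definitionally those of Defs.QS, and XF (series over QF) those of
-- Defs.XY.
module RationalSeries where
  open import Algebra.Bundles using (CommutativeRing)
  open import Data.Nat as ℕ using (ℕ; zero; suc; _∸_; _<_)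
  import Data.Nat.Properties as ℕP
  open import Data.Rational as ℚ using (ℚ; 0ℚ; 1ℚ)
  import Data.Rational.Properties as ℚP
  open import Relation.Binary.PropositionalEquality as P using (_≡_; _≢_; refl)
  open import Relation.Nullary using (yes; no)
  open import Data.Maybe using (Maybe; just; nothing)
  open import Data.Sum using (inj₁; inj₂)
  open import Data.Fin using (Fin) renaming (zero to f0; suc to fs)
  open import Data.Vec as Vec using (Vec; []; _∷_)
  import Data.Vec.Properties as VecP
  import Algebra.Solver.Ring as RingSolver
  import Algebra.Solver.Ring.AlmostCommutativeRing as ACR
  import Data.Rational.Solver

  module QF = PowerSeries ℚP.+-*-commutativeRing
  module XF = PowerSeries QF.psRing
  module PSQ = CommutativeRing QF.psRing
  open import Algebra.Properties.Group PSQ.+-group public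
    using (x∙y⁻¹≈ε⇒x≈y; x≈y⇒x∙y⁻¹≈ε; ∙-cancelˡ)

  open QF using (_≋_) public

  *≡0⇒≡0 : ∀ x y → x ℚ.* y ≡ 0ℚ → y ≢ 0ℚ → x ≡ 0ℚ
  *≡0⇒≡0 x y xy≡0 y≢0 = begin
    x                    ≡⟨ P.sym (ℚP.*-identityʳ x) ⟩
    x ℚ.* 1ℚ             ≡⟨ P.cong (x ℚ.*_) (P.sym (ℚP.*-inverseʳ y)) ⟩
    x ℚ.* (y ℚ.* ℚ.1/ y) ≡⟨ P.sym (ℚP.*-assoc x y _) ⟩
    (x ℚ.* y) ℚ.* ℚ.1/ y ≡⟨ P.cong (ℚ._* _) xy≡0 ⟩
    0ℚ ℚ.* ℚ.1/ y        ≡⟨ ℚP.*-zeroˡ (ℚ.1/ y) ⟩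
    0ℚ                   ∎
    where
    open P.≡-Reasoning
    instance _ = ℚ.≢-nonZero y≢0

  *-≢0 : ∀ x y → x ≢ 0ℚ → y ≢ 0ℚ → x ℚ.* y ≢ 0ℚ
  *-≢0 x y x≢0 y≢0 e = x≢0 (*≡0⇒≡0 x y e y≢0)

  module ℚS = Data.Rational.Solver.+-*-Solver
  open ℚS public using ()
    renaming (solve to solveℚ; _:+_ to _q+_; _:*_ to _q*_; _:=_ to _q=_; con to qc; :-_ to q-_)

  private
    ℚ-rawRing = CommutativeRing.rawRing ℚP.+-*-commutativeRing

    const-morphism : ℚ-rawRing ACR.-Raw-AlmostCommutative⟶ ACR.fromCommutativeRing QF.psRing
    const-morphism = record
      { ⟦_⟧    = QF.const
      ; +-homo = QF.const-+
      ; *-homo = λ c d → QF.≋-sym (QF.const-* c d)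
      ; -‿homo = λ c → QF.≋-sym (QF.const-neg c)
      ; 0-homo = QF.≋-refl
      ; 1-homo = QF.≋-refl }

    const≟ : ∀ c d → Maybe (QF.const c ≋ QF.const d)
    const≟ c d with c ℚ.≟ d
    ... | yes refl = just QF.≋-refl
    ... | no _     = nothing

  module SeriesSolver =
    RingSolver ℚ-rawRing (ACR.fromCommutativeRing QF.psRing) const-morphism const≟

  open SeriesSolver using (solve; _:=_; _:+_; _:*_; _:-_; con; :-_) public

  0S : QF.PS
  0S = QF.const 0ℚ

  0S-coeff : ∀ n → 0S n ≡ 0ℚ
  0S-coeff zero    = refl
  0S-coeff (suc n) = refl

  ⊛≋0⇒≋0 : ∀ h q → (h QF.⊛ q) ≋ 0S → q 0 ≢ 0ℚ → h ≋ 0S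
  ⊛≋0⇒≋0 h q hq≋0 q0≢0 n = P.trans (below (suc n) n (ℕP.n<1+n n)) (P.sym (0S-coeff n))
    where
    below : ∀ N i → i < N → h i ≡ 0ℚ
    below (suc N) i i<sN with ℕP.m≤n⇒m<n∨m≡n (ℕP.≤-pred i<sN)
    ... | inj₁ i<N  = below N i i<N
    ... | inj₂ refl = *≡0⇒≡0 (h i) (q 0) hᵢq₀≡0 q0≢0
      where
      earlier : QF.sumTo (λ j → h j ℚ.* q (i ∸ j)) i ≡ 0ℚ
      earlier = QF.sum-zero i (λ j j<i →
        P.trans (P.cong (ℚ._* q (i ∸ j)) (below i j j<i)) (ℚP.*-zeroˡ (q (i ∸ j))))
      hᵢq₀≡0 : h i ℚ.* q 0 ≡ 0ℚ
      hᵢq₀≡0 = begin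
        h i ℚ.* q 0                   ≡⟨ P.cong (λ z → h i ℚ.* q z) (P.sym (ℕP.n∸n≡0 i)) ⟩
        h i ℚ.* q (i ∸ i)             ≡⟨ P.sym (ℚP.+-identityˡ _) ⟩
        0ℚ ℚ.+ h i ℚ.* q (i ∸ i)      ≡⟨ P.cong (ℚ._+ (h i ℚ.* q (i ∸ i))) (P.sym earlier) ⟩
        (h QF.⊛ q) i                  ≡⟨ P.trans (hq≋0 i) (0S-coeff i) ⟩
        0ℚ                            ∎
        where open P.≡-Reasoning

  ⊛-cancelʳ : ∀ s t q → (s QF.⊛ q) ≋ (t QF.⊛ q) → q 0 ≢ 0ℚ → s ≋ t
  ⊛-cancelʳ s t q e q0≢0 = x∙y⁻¹≈ε⇒x≈y s t (⊛≋0⇒≋0 (s PSQ.- t) q difference q0≢0)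
    where
    open import Relation.Binary.Reasoning.Setoid PSQ.setoid
    difference : ((s PSQ.- t) PSQ.* q) ≋ 0S
    difference = begin
      (s PSQ.- t) PSQ.* q               ≈⟨ PSQ.distribʳ q s (PSQ.- t) ⟩
      s PSQ.* q PSQ.+ (PSQ.- t) PSQ.* q ≈⟨ PSQ.+-cong e (solve 2 (λ t q → (:- t) :* q := :- (t :* q)) PSQ.refl t q) ⟩
      t PSQ.* q PSQ.- t PSQ.* q         ≈⟨ PSQ.-‿inverseʳ (t PSQ.* q) ⟩
      0S                                ∎

  -- a square root is determined by its constant term (char ℚ ≠ 2):
  -- W² = V² gives (W - V)(W + V) = 0, and W + V has constant term 2 V 0 ≠ 0
  sqrt-unique : ∀ W V → (W QF.⊛ W) ≋ (V QF.⊛ V) → W 0 ≡ V 0 → V 0 ℚ.+ V 0 ≢ 0ℚ → W ≋ V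
  sqrt-unique W V e W0≡V0 2V0≢0 =
    x∙y⁻¹≈ε⇒x≈y W V (⊛≋0⇒≋0 (W PSQ.- V) (W PSQ.+ V) difference sum0≢0)
    where
    open import Relation.Binary.Reasoning.Setoid PSQ.setoid
    difference : ((W PSQ.- V) PSQ.* (W PSQ.+ V)) ≋ 0S
    difference = begin
      (W PSQ.- V) PSQ.* (W PSQ.+ V) ≈⟨ solve 2 (λ s t → (s :- t) :* (s :+ t) := (s :* s) :- (t :* t)) PSQ.refl W V ⟩
      (W PSQ.* W) PSQ.- (V PSQ.* V) ≈⟨ PSQ.+-congʳ e ⟩
      (V PSQ.* V) PSQ.- (V PSQ.* V) ≈⟨ PSQ.-‿inverseʳ (V PSQ.* V) ⟩
      0S                            ∎
    sum0≢0 : (W PSQ.+ V) 0 ≢ 0ℚ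
    sum0≢0 z = 2V0≢0 (P.trans (P.cong (ℚ._+ V 0) (P.sym W0≡V0)) z)

  -- Polynomial expressions in series variables with rational constants.
  -- Substitution commutes with them, and their constant term is the
  -- same expression evaluated at the constant terms.

  infixl 6 _⊞_
  infixl 7 _⊠_
  data Expr (n : ℕ) : Set where
    _⊞_ _⊠_ : Expr n → Expr n → Expr n
    ⊟_      : Expr n → Expr n
    κ       : ℚ → Expr n
    ν       : Fin n → Expr n

  ⟦_⟧ : ∀ {n} → Expr n → Vec QF.PS n → QF.PS
  ⟦ e₁ ⊞ e₂ ⟧ ρ = ⟦ e₁ ⟧ ρ QF.⊕ ⟦ e₂ ⟧ ρ
  ⟦ e₁ ⊠ e₂ ⟧ ρ = ⟦ e₁ ⟧ ρ QF.⊛ ⟦ e₂ ⟧ ρ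
  ⟦ ⊟ e ⟧     ρ = QF.⊖ ⟦ e ⟧ ρ
  ⟦ κ c ⟧     ρ = QF.const c
  ⟦ ν i ⟧     ρ = Vec.lookup ρ i

  ⟦_⟧₀ : ∀ {n} → Expr n → Vec ℚ n → ℚ
  ⟦ e₁ ⊞ e₂ ⟧₀ r = ⟦ e₁ ⟧₀ r ℚ.+ ⟦ e₂ ⟧₀ r
  ⟦ e₁ ⊠ e₂ ⟧₀ r = ⟦ e₁ ⟧₀ r ℚ.* ⟦ e₂ ⟧₀ r
  ⟦ ⊟ e ⟧₀     r = ℚ.- ⟦ e ⟧₀ r
  ⟦ κ c ⟧₀     r = c
  ⟦ ν i ⟧₀     r = Vec.lookup r i

  ⟦⟧-cong : ∀ {n} (e : Expr n) {ρ σ : Vec QF.PS n} →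
            (∀ i → Vec.lookup ρ i ≋ Vec.lookup σ i) → ⟦ e ⟧ ρ ≋ ⟦ e ⟧ σ
  ⟦⟧-cong (e₁ ⊞ e₂) h = PSQ.+-cong (⟦⟧-cong e₁ h) (⟦⟧-cong e₂ h)
  ⟦⟧-cong (e₁ ⊠ e₂) h = PSQ.*-cong (⟦⟧-cong e₁ h) (⟦⟧-cong e₂ h)
  ⟦⟧-cong (⊟ e)     h = PSQ.-‿cong (⟦⟧-cong e h)
  ⟦⟧-cong (κ c)     h = QF.≋-refl
  ⟦⟧-cong (ν i)     h = h i

  x₀ : ∀ {n} → Expr (suc n)
  x₀ = ν f0
  x₁ : ∀ {n} → Expr (suc (suc n))
  x₁ = ν (fs f0)
  x₂ : ∀ {n} → Expr (suc (suc (suc n)))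
  x₂ = ν (fs (fs f0))

  ⟦⟧-cong₁ : ∀ (e : Expr 1) {x y} → x ≋ y → ⟦ e ⟧ (x ∷ []) ≋ ⟦ e ⟧ (y ∷ [])
  ⟦⟧-cong₁ e h = ⟦⟧-cong e λ { f0 → h }

  ⟦⟧-cong₂ : ∀ (e : Expr 2) {x y u v} → x ≋ y → u ≋ v → ⟦ e ⟧ (x ∷ u ∷ []) ≋ ⟦ e ⟧ (y ∷ v ∷ [])
  ⟦⟧-cong₂ e h k = ⟦⟧-cong e λ { f0 → h ; (fs f0) → k }

  ⟦⟧-cong₃ : ∀ (e : Expr 3) {x y u v s t} → x ≋ y → u ≋ v → s ≋ t →
             ⟦ e ⟧ (x ∷ u ∷ s ∷ []) ≋ ⟦ e ⟧ (y ∷ v ∷ t ∷ [])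
  ⟦⟧-cong₃ e h k l = ⟦⟧-cong e λ { f0 → h ; (fs f0) → k ; (fs (fs f0)) → l }

  ⟦⟧-coeff0 : ∀ {n} (e : Expr n) (ρ : Vec QF.PS n) → ⟦ e ⟧ ρ 0 ≡ ⟦ e ⟧₀ (Vec.map (λ s → s 0) ρ)
  ⟦⟧-coeff0 (e₁ ⊞ e₂) ρ = P.cong₂ ℚ._+_ (⟦⟧-coeff0 e₁ ρ) (⟦⟧-coeff0 e₂ ρ)
  ⟦⟧-coeff0 (e₁ ⊠ e₂) ρ =
    P.trans (QF.⊛-0 (⟦ e₁ ⟧ ρ) (⟦ e₂ ⟧ ρ)) (P.cong₂ ℚ._*_ (⟦⟧-coeff0 e₁ ρ) (⟦⟧-coeff0 e₂ ρ))
  ⟦⟧-coeff0 (⊟ e)     ρ = P.cong ℚ.-_ (⟦⟧-coeff0 e ρ)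
  ⟦⟧-coeff0 (κ c)     ρ = refl
  ⟦⟧-coeff0 (ν i)     ρ = P.sym (VecP.lookup-map i (λ s → s 0) ρ)

  module ExprSubstitution (F : QF.PS) (F0 : F 0 ≡ 0ℚ) where
    open QF.Substitution F F0 public
    open import Algebra.Properties.Ring (CommutativeRing.ring ℚP.+-*-commutativeRing)
      using (-1*x≈-x)

    compose-⊖ : ∀ v → compose (QF.⊖ v) ≋ QF.⊖ compose v
    compose-⊖ v = QF.≋-trans (compose-cong (λ n → P.sym (-1*x≈-x (v n))))
                    (QF.≋-trans (compose-· (ℚ.- 1ℚ) v) (λ n → -1*x≈-x (compose v n)))

    compose-⟦⟧ : ∀ {n} (e : Expr n) (ρ : Vec QF.PS n) → compose (⟦ e ⟧ ρ) ≋ ⟦ e ⟧ (Vec.map compose ρ)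
    compose-⟦⟧ (e₁ ⊞ e₂) ρ =
      QF.≋-trans (compose-⊕ (⟦ e₁ ⟧ ρ) (⟦ e₂ ⟧ ρ)) (PSQ.+-cong (compose-⟦⟧ e₁ ρ) (compose-⟦⟧ e₂ ρ))
    compose-⟦⟧ (e₁ ⊠ e₂) ρ =
      QF.≋-trans (compose-⊛ (⟦ e₁ ⟧ ρ) (⟦ e₂ ⟧ ρ)) (PSQ.*-cong (compose-⟦⟧ e₁ ρ) (compose-⟦⟧ e₂ ρ))
    compose-⟦⟧ (⊟ e) ρ = QF.≋-trans (compose-⊖ (⟦ e ⟧ ρ)) (PSQ.-‿cong (compose-⟦⟧ e ρ))
    compose-⟦⟧ (κ c) ρ = compose-const c
    compose-⟦⟧ (ν i) ρ n = P.cong (λ s → s n) (P.sym (VecP.lookup-map i compose ρ))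

  ≋t : ∀ {x y z} → x ≋ y → y ≋ z → x ≋ z
  ≋t = QF.≋-trans

  ≋s : ∀ {x y} → x ≋ y → y ≋ x
  ≋s = QF.≋-sym

  ⊛ˡ : ∀ {x y} (z : QF.PS) → x ≋ y → (x QF.⊛ z) ≋ (y QF.⊛ z)
  ⊛ˡ {x} {y} z h = QF.⊛-cong {x} {y} {z} {z} h QF.≋-refl

  ⊛ʳ : ∀ (z : QF.PS) {x y} → x ≋ y → (z QF.⊛ x) ≋ (z QF.⊛ y)
  ⊛ʳ z {x} {y} h = QF.⊛-cong {z} {z} {x} {y} QF.≋-refl h

  ⊕ˡ : ∀ {x y} (z : QF.PS) → x ≋ y → (x QF.⊕ z) ≋ (y QF.⊕ z)
  ⊕ˡ z h n = P.cong (ℚ._+ z n) (h n)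

  ⊕ʳ : ∀ (z : QF.PS) {x y} → x ≋ y → (z QF.⊕ x) ≋ (z QF.⊕ y)
  ⊕ʳ z h n = P.cong (z n ℚ.+_) (h n)

  ⊕c : ∀ {x y u v} → x ≋ y → u ≋ v → (x QF.⊕ u) ≋ (y QF.⊕ v)
  ⊕c h k n = P.cong₂ ℚ._+_ (h n) (k n)

  +-vanishing : ∀ {x} r → x ≋ 0S → (r QF.⊕ x) ≋ r
  +-vanishing r h = ≋t (⊕ʳ r h) (PSQ.+-identityʳ r)

  +-difference : ∀ {p q} r → p ≋ q → (r QF.⊕ (p QF.⊕ (QF.⊖ q))) ≋ r
  +-difference r h = +-vanishing r (x≈y⇒x∙y⁻¹≈ε h)

  ⊛-square : ∀ z d → ((z QF.⊛ d) QF.⊛ (z QF.⊛ d)) ≋ ((z QF.⊛ z) QF.⊛ (d QF.⊛ d))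
  ⊛-square = solve 2 (λ z d → (z :* d) :* (z :* d) := (z :* z) :* (d :* d)) PSQ.refl

-- The polynomials of the theorem, written once over an abstract signature
-- (𝔸, 𝔹 stand for the parameters a, b) so that the same formula can be
-- read as syntax for the series ring solver, for the ℚ solver, or as an
-- Expr through which substitution can be pushed.
module Formulas where
  open import Data.Rational using (1ℚ)
  open RationalSeries using (module ℚS; module SeriesSolver)

  record Signature (C : Set) : Set where
    infixl 6 _⊕'_
    infixl 7 _⊛'_
    field
      _⊕'_ _⊛'_ : C → C → C
      ⊖'_       : C → C
      𝟙 𝔸 𝔹     : C

  ℚ-signature : ∀ {m} → ℚS.Polynomial m → ℚS.Polynomial m → Signature (ℚS.Polynomial m)
  ℚ-signature A B = record
    { _⊕'_ = ℚS._:+_ ; _⊛'_ = ℚS._:*_ ; ⊖'_ = ℚS.:-_ ; 𝟙 = ℚS.con 1ℚ ; 𝔸 = A ; 𝔹 = B }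

  series-signature : ∀ {m} → SeriesSolver.Polynomial m → SeriesSolver.Polynomial m →
                     Signature (SeriesSolver.Polynomial m)
  series-signature A B = record
    { _⊕'_ = SeriesSolver._:+_ ; _⊛'_ = SeriesSolver._:*_ ; ⊖'_ = SeriesSolver.:-_
    ; 𝟙 = SeriesSolver.con 1ℚ ; 𝔸 = A ; 𝔹 = B }

  module Polys {C : Set} (σ : Signature C) where
    open Signature σ public
    infixl 6 _⊖'_
    _⊖'_ : C → C → C
    x ⊖' y = x ⊕' (⊖' y)
    𝟚 𝟜 : C
    𝟚 = 𝟙 ⊕' 𝟙
    𝟜 = 𝟚 ⊕' 𝟚
    c₀ c₁ : C
    c₀ = 𝟙 ⊖' 𝔸 ⊕' 𝟚 ⊛' 𝔹
    c₁ = (𝔸 ⊖' 𝟙) ⊛' (𝔸 ⊖' 𝟜 ⊛' 𝔹)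
    twoB : C
    twoB = 𝟚 ⊛' 𝔹
    -- den = 1 + a x + b x² ;  L = ((num₀ + y num₁) / den, x / den)
    den num₀ num₁ rad V lin : C → C
    den x  = 𝟙 ⊕' 𝔸 ⊛' x ⊕' 𝔹 ⊛' (x ⊛' x)
    num₀ x = 𝟙 ⊕' (𝟚 ⊖' 𝔸) ⊛' x ⊕' (⊖' 𝔸 ⊕' 𝔹 ⊕' 𝟙) ⊛' (x ⊛' x)
    num₁ x = x ⊕' x ⊛' x
    -- rad = S², and S(x / den) = V / den
    rad x  = 𝟙 ⊕' (⊖' (𝟚 ⊛' 𝔸)) ⊛' x ⊕' (𝔸 ⊛' 𝔸 ⊖' 𝟜 ⊛' 𝔹) ⊛' (x ⊛' x)
    V x    = 𝟙 ⊖' 𝔹 ⊛' (x ⊛' x)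
    -- lin z = (a - 1) z - 1, and it turns out that g = lin f / lin x
    lin z  = (𝔸 ⊖' 𝟙) ⊛' z ⊖' 𝟙
    denG numF R : C → C → C
    denG x s = (c₀ ⊕' c₁ ⊛' x) ⊕' (𝔸 ⊖' 𝟙) ⊛' s
    numF x s = (s ⊕' (𝔸 ⊖' 𝟚 ⊛' 𝔹) ⊛' x) ⊕' ⊖' 𝟙
    -- f = numF x S / denG x S  is equivalent to  S · lin f = R x f
    R x z    = ((𝔸 ⊖' 𝟚 ⊛' 𝔹) ⊛' x ⊖' 𝟙) ⊖' z ⊛' (c₀ ⊕' c₁ ⊛' x)
    -- Q x z = rad x · lin z² - (R x z)², which is symmetric in x and z
    Q : C → C → C
    Q x z = rad x ⊛' (lin z ⊛' lin z) ⊖' R x z ⊛' R x z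
    -- the x-side quantities multiplied by den, with u = F₀ den, w = S(F₀) den
    radDen : C → C → C
    radDen u x = den x ⊛' den x ⊕' (⊖' (𝟚 ⊛' 𝔸)) ⊛' u ⊛' den x ⊕' (𝔸 ⊛' 𝔸 ⊖' 𝟜 ⊛' 𝔹) ⊛' (u ⊛' u)
    denGDen numFDen : C → C → C → C
    denGDen u w x = c₀ ⊛' den x ⊕' c₁ ⊛' u ⊕' (𝔸 ⊖' 𝟙) ⊛' w
    numFDen u w x = w ⊕' (𝔸 ⊖' 𝟚 ⊛' 𝔹) ⊛' u ⊖' den x

module Concrete (a b : ℚ) where
  open import Data.Nat as ℕ using (ℕ; suc)
  open import Data.Fin using () renaming (zero to f0; suc to fs)
  open import Data.Rational as ℚ using (ℚ; 0ℚ; 1ℚ)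
  import Data.Rational.Properties as ℚP
  open import Relation.Binary.PropositionalEquality as P using (_≡_; _≢_; refl)
  open import Data.Vec as Vec using ([]; _∷_)
  open import Defs
  open RationalSeries
  open Formulas

  expr-signature : ∀ {n} → Signature (Expr n)
  expr-signature = record
    { _⊕'_ = _⊞_ ; _⊛'_ = _⊠_ ; ⊖'_ = ⊟_ ; 𝟙 = κ 1ℚ ; 𝔸 = κ a ; 𝔹 = κ b }

  module E {n} = Polys (expr-signature {n})

  denˢ num₀ˢ num₁ˢ radˢ Vˢ linˢ : QF.PS → QF.PS
  denˢ  x = ⟦ E.den x₀ ⟧ (x ∷ [])
  num₀ˢ x = ⟦ E.num₀ x₀ ⟧ (x ∷ [])
  num₁ˢ x = ⟦ E.num₁ x₀ ⟧ (x ∷ [])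
  radˢ  x = ⟦ E.rad x₀ ⟧ (x ∷ [])
  Vˢ    x = ⟦ E.V x₀ ⟧ (x ∷ [])
  linˢ  z = ⟦ E.lin x₀ ⟧ (z ∷ [])

  denGˢ numFˢ Rˢ Qˢ : QF.PS → QF.PS → QF.PS
  denGˢ x s = ⟦ E.denG x₀ x₁ ⟧ (x ∷ s ∷ [])
  numFˢ x s = ⟦ E.numF x₀ x₁ ⟧ (x ∷ s ∷ [])
  Rˢ    x z = ⟦ E.R x₀ x₁ ⟧ (x ∷ z ∷ [])
  Qˢ    x z = ⟦ E.Q x₀ x₁ ⟧ (x ∷ z ∷ [])

  closed : Expr 0 → QF.PS
  closed e = ⟦ e ⟧ []

  2B a-1 : QF.PS
  2B  = closed E.twoB
  a-1 = closed (E.𝔸 ⊞ ⊟ E.𝟙)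

  X : QF.PS
  X = QF.X

  value : Expr 0 → ℚ
  value (e₁ ⊞ e₂) = value e₁ ℚ.+ value e₂
  value (e₁ ⊠ e₂) = value e₁ ℚ.* value e₂
  value (⊟ e)     = ℚ.- value e
  value (κ c)     = c
  value (ν ())

  const-closed : ∀ (e : Expr 0) → QF.const (value e) ≋ closed e
  const-closed (e₁ ⊞ e₂) = ≋t (QF.const-+ (value e₁) (value e₂)) (PSQ.+-cong (const-closed e₁) (const-closed e₂))
  const-closed (e₁ ⊠ e₂) = ≋t (≋s (QF.const-* (value e₁) (value e₂))) (PSQ.*-cong (const-closed e₁) (const-closed e₂))
  const-closed (⊟ e)     = ≋t (≋s (QF.const-neg (value e))) (PSQ.-‿cong (const-closed e))
  const-closed (κ c)     = QF.≋-refl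
  const-closed (ν ())

  quadratic : ℚ → ℚ → ℚ → QF.PS
  quadratic k₀ k₁ k₂ 0 = k₀
  quadratic k₀ k₁ k₂ 1 = k₁
  quadratic k₀ k₁ k₂ 2 = k₂
  quadratic k₀ k₁ k₂ _ = 0ℚ

  X²-coeff0 : (X QF.⊛ X) 0 ≡ 0ℚ
  X²-coeff0 = QF.X-⊛-0 X

  X²-coeff-suc : ∀ n → (X QF.⊛ X) (suc n) ≡ X n
  X²-coeff-suc n = QF.X-⊛-suc X n

  quadratic-≋ : ∀ k₀ k₁ k₂ →
    ((QF.const k₀ QF.⊕ (QF.const k₁ QF.⊛ X)) QF.⊕ (QF.const k₂ QF.⊛ (X QF.⊛ X))) ≋ quadratic k₀ k₁ k₂
  quadratic-≋ k₀ k₁ k₂ n =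
    P.trans (P.cong₂ ℚ._+_ (P.cong (QF.const k₀ n ℚ.+_) (QF.const-⊛ k₁ X n)) (QF.const-⊛ k₂ (X QF.⊛ X) n))
            (coeff n)
    where
    coeff : ∀ n → (QF.const k₀ n ℚ.+ k₁ ℚ.* X n) ℚ.+ k₂ ℚ.* (X QF.⊛ X) n ≡ quadratic k₀ k₁ k₂ n
    coeff 0 = P.trans (P.cong (λ z → (k₀ ℚ.+ k₁ ℚ.* 0ℚ) ℚ.+ k₂ ℚ.* z) X²-coeff0)
      (solveℚ 3 (λ x y z → (x q+ y q* qc 0ℚ) q+ z q* qc 0ℚ q= x) refl k₀ k₁ k₂)
    coeff 1 = P.trans (P.cong (λ z → (0ℚ ℚ.+ k₁ ℚ.* 1ℚ) ℚ.+ k₂ ℚ.* z) (X²-coeff-suc 0))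
      (solveℚ 2 (λ y z → (qc 0ℚ q+ y q* qc 1ℚ) q+ z q* qc 0ℚ q= y) refl k₁ k₂)
    coeff 2 = P.trans (P.cong (λ z → (0ℚ ℚ.+ k₁ ℚ.* 0ℚ) ℚ.+ k₂ ℚ.* z) (X²-coeff-suc 1))
      (solveℚ 2 (λ y z → (qc 0ℚ q+ y q* qc 0ℚ) q+ z q* qc 1ℚ q= z) refl k₁ k₂)
    coeff (suc (suc (suc n))) = P.trans (P.cong (λ z → (0ℚ ℚ.+ k₁ ℚ.* 0ℚ) ℚ.+ k₂ ℚ.* z) (X²-coeff-suc (2 ℕ.+ n)))
      (solveℚ 2 (λ y z → (qc 0ℚ q+ y q* qc 0ℚ) q+ z q* qc 0ℚ q= qc 0ℚ) refl k₁ k₂)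

  quadratic-template : Expr 4
  quadratic-template = ν f0 ⊞ ν (fs f0) ⊠ x ⊞ ν (fs (fs f0)) ⊠ (x ⊠ x)
    where x = ν (fs (fs (fs f0)))

  quadratic-formula : ∀ (k₀ k₁ k₂ : Expr 0) →
    ⟦ quadratic-template ⟧ (closed k₀ ∷ closed k₁ ∷ closed k₂ ∷ X ∷ [])
      ≋ quadratic (value k₀) (value k₁) (value k₂)
  quadratic-formula k₀ k₁ k₂ =
    ≋t (⟦⟧-cong quadratic-template {closed k₀ ∷ closed k₁ ∷ closed k₂ ∷ X ∷ []}
                {QF.const (value k₀) ∷ QF.const (value k₁) ∷ QF.const (value k₂) ∷ X ∷ []}
         λ { f0 → ≋s (const-closed k₀) ; (fs f0) → ≋s (const-closed k₁)
           ; (fs (fs f0)) → ≋s (const-closed k₂) ; (fs (fs (fs f0))) → QF.≋-refl })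
       (quadratic-≋ (value k₀) (value k₁) (value k₂))

  denQ : QF.PS
  denQ = quadratic 1ℚ a b

  denL-const : ∀ n → denL a b n ≡ QF.const (denQ n)
  denL-const 0 = refl
  denL-const 1 = refl
  denL-const 2 = refl
  denL-const (suc (suc (suc n))) = refl

  denˢ-X : denˢ X ≋ denQ
  denˢ-X = quadratic-≋ 1ℚ a b

  radicand-X : radicand a b ≋ radˢ X
  radicand-X = ≋t shape (≋s (quadratic-formula E.𝟙 (⊟ (E.𝟚 ⊠ E.𝔸)) (E.𝔸 ⊠ E.𝔸 ⊞ ⊟ (E.𝟜 ⊠ E.𝔹))))
    where
    shape : ∀ n → radicand a b n ≡ quadratic 1ℚ (ℚ.- (2ℚ ℚ.* a)) (a ℚ.* a ℚ.- 4ℚ ℚ.* b) n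
    shape 0 = refl
    shape 1 = refl
    shape 2 = refl
    shape (suc (suc (suc n))) = refl

  num₀ˢ-X : num₀ˢ X ≋ quadratic 1ℚ (2ℚ ℚ.- a) (ℚ.- a ℚ.+ b ℚ.+ 1ℚ)
  num₀ˢ-X = quadratic-formula E.𝟙 (E.𝟚 ⊞ ⊟ E.𝔸) (⊟ E.𝔸 ⊞ E.𝔹 ⊞ E.𝟙)

  num₁ˢ-X : num₁ˢ X ≋ quadratic 0ℚ 1ℚ 1ℚ
  num₁ˢ-X 0 = P.trans (P.cong (0ℚ ℚ.+_) X²-coeff0) (ℚP.+-identityˡ _)
  num₁ˢ-X 1 = P.trans (P.cong (1ℚ ℚ.+_) (X²-coeff-suc 0)) (ℚP.+-identityʳ _)
  num₁ˢ-X (suc (suc n)) = P.trans (P.cong (X (suc (suc n)) ℚ.+_) (X²-coeff-suc (suc n))) (lemma n)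
    where
    lemma : ∀ n → X (suc (suc n)) ℚ.+ X (suc n) ≡ quadratic 0ℚ 1ℚ 1ℚ (suc (suc n))
    lemma 0       = ℚP.+-identityˡ _
    lemma (suc n) = ℚP.+-identityˡ _

  denG-shape : ∀ S → denG a b S ≋ denGˢ X S
  denG-shape S =
    ⊕c (⊕c (const-closed E.c₀) (≋t (QF.·-as-const (value E.c₁) X) (⊛ˡ X (const-closed E.c₁))))
       (≋t (QF.·-as-const (value (E.𝔸 ⊞ ⊟ E.𝟙)) S) (⊛ˡ S (const-closed (E.𝔸 ⊞ ⊟ E.𝟙))))

  numF-shape : ∀ S → numF a b S ≋ numFˢ X S
  numF-shape S =
    ⊕c (⊕ʳ S (≋t (QF.·-as-const (value (E.𝔸 ⊞ ⊟ (E.𝟚 ⊠ E.𝔹))) X)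
                  (⊛ˡ X (const-closed (E.𝔸 ⊞ ⊟ (E.𝟚 ⊠ E.𝔹))))))
       (const-closed (⊟ E.𝟙))

  2b-shape : QF.const (2ℚ ℚ.* b) ≋ 2B
  2b-shape = const-closed E.twoB

  private
    A' B' : QF.PS
    A' = QF.const a
    B' = QF.const b

  -- x-side.  For F with F den = x these turn rad(F), denG(F, ·), numF(F, ·)
  -- multiplied by den into polynomials in x.

  rad-den² : ∀ F x → (radˢ F QF.⊛ (denˢ x QF.⊛ denˢ x)) ≋ ⟦ E.radDen x₀ x₁ ⟧ ((F QF.⊛ denˢ x) ∷ x ∷ [])
  rad-den² F x = solve 4 (λ F x A B → let module Q = Polys (series-signature A B) in
    Q.rad F :* (Q.den x :* Q.den x) := Q.radDen (F :* Q.den x) x) PSQ.refl F x A' B'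

  radDen-at-x : ∀ x → ⟦ E.radDen x₀ x₁ ⟧ (x ∷ x ∷ []) ≋ (Vˢ x QF.⊛ Vˢ x)
  radDen-at-x x = solve 3 (λ x A B → let module Q = Polys (series-signature A B) in
    Q.radDen x x := Q.V x :* Q.V x) PSQ.refl x A' B'

  denG-den : ∀ F Z x → (denGˢ F Z QF.⊛ denˢ x) ≋
                       ⟦ E.denGDen x₀ x₁ x₂ ⟧ ((F QF.⊛ denˢ x) ∷ (Z QF.⊛ denˢ x) ∷ x ∷ [])
  denG-den F Z x = solve 5 (λ F Z x A B → let module Q = Polys (series-signature A B) in
    Q.denG F Z :* Q.den x := Q.denGDen (F :* Q.den x) (Z :* Q.den x) x) PSQ.refl F Z x A' B'

  denGDen-at-x : ∀ x → ⟦ E.denGDen x₀ x₁ x₂ ⟧ (x ∷ Vˢ x ∷ x ∷ []) ≋ (2B QF.⊛ num₀ˢ x)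
  denGDen-at-x x = solve 3 (λ x A B → let module Q = Polys (series-signature A B) in
    Q.denGDen x (Q.V x) x := Q.twoB :* Q.num₀ x) PSQ.refl x A' B'

  numF-den : ∀ F Z x → (numFˢ F Z QF.⊛ denˢ x) ≋
                       ⟦ E.numFDen x₀ x₁ x₂ ⟧ ((F QF.⊛ denˢ x) ∷ (Z QF.⊛ denˢ x) ∷ x ∷ [])
  numF-den F Z x = solve 5 (λ F Z x A B → let module Q = Polys (series-signature A B) in
    Q.numF F Z :* Q.den x := Q.numFDen (F :* Q.den x) (Z :* Q.den x) x) PSQ.refl F Z x A' B'

  numFDen-at-x : ∀ x → (⟦ E.numFDen x₀ x₁ x₂ ⟧ (x ∷ Vˢ x ∷ x ∷ []) QF.⊕ (2B QF.⊛ num₁ˢ x)) ≋ 0S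
  numFDen-at-x x = solve 3 (λ x A B → let module Q = Polys (series-signature A B) in
    Q.numFDen x (Q.V x) x :+ Q.twoB :* Q.num₁ x := con 0ℚ) PSQ.refl x A' B'

  -- f-side.  The defining equation  f denG(x, S) = numF(x, S)  is
  -- equivalent to  S lin f = R(x, f),  and modulo it  denG(x, S) lin f
  -- collapses to  2b lin x.

  S-lin : ∀ S f x → (S QF.⊛ linˢ f) ≋ (Rˢ x f QF.⊕ ((f QF.⊛ denGˢ x S) QF.⊕ (QF.⊖ numFˢ x S)))
  S-lin S f x = solve 5 (λ S f x A B → let module Q = Polys (series-signature A B) in
    S :* Q.lin f := Q.R x f :+ ((f :* Q.denG x S) :+ (:- Q.numF x S))) PSQ.refl S f x A' B'

  denG-lin : ∀ S f x → (denGˢ x S QF.⊛ linˢ f) ≋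
                       ((2B QF.⊛ linˢ x) QF.⊕ (a-1 QF.⊛ ((S QF.⊛ linˢ f) QF.⊕ (QF.⊖ Rˢ x f))))
  denG-lin S f x = solve 5 (λ S f x A B → let module Q = Polys (series-signature A B) in
    Q.denG x S :* Q.lin f := (Q.twoB :* Q.lin x) :+ ((A :+ (:- Q.𝟙)) :* ((S :* Q.lin f) :+ (:- Q.R x f))))
    PSQ.refl S f x A' B'

  Q-symmetric : ∀ x z → Qˢ z x ≋ Qˢ x z
  Q-symmetric x z = solve 4 (λ x z A B → let module Q = Polys (series-signature A B) in
    Q.Q z x := Q.Q x z) PSQ.refl x z A' B'

  2b : ℚ
  2b = 2ℚ ℚ.* b

  2B-coeff0 : 2B 0 ≡ 2b
  2B-coeff0 = ⟦⟧-coeff0 E.twoB []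

  module _ {m} (A B : ℚS.Polynomial m) where
    module Qℚ = Polys (ℚ-signature A B)

  den-coeff0 : ∀ x → x 0 ≡ 0ℚ → denˢ x 0 ≡ 1ℚ
  den-coeff0 x x0 = P.trans (⟦⟧-coeff0 (E.den x₀) (x ∷ []))
    (P.trans (P.cong (λ u → ⟦ E.den x₀ ⟧₀ (u ∷ [])) x0)
             (solveℚ 2 (λ A B → Qℚ.den A B (qc 0ℚ) q= qc 1ℚ) refl a b))

  V-coeff0 : ∀ x → x 0 ≡ 0ℚ → Vˢ x 0 ≡ 1ℚ
  V-coeff0 x x0 = P.trans (⟦⟧-coeff0 (E.V x₀) (x ∷ []))
    (P.trans (P.cong (λ u → ⟦ E.V x₀ ⟧₀ (u ∷ [])) x0)
             (solveℚ 2 (λ A B → Qℚ.V A B (qc 0ℚ) q= qc 1ℚ) refl a b))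

  num₀-coeff0 : ∀ x → x 0 ≡ 0ℚ → num₀ˢ x 0 ≡ 1ℚ
  num₀-coeff0 x x0 = P.trans (⟦⟧-coeff0 (E.num₀ x₀) (x ∷ []))
    (P.trans (P.cong (λ u → ⟦ E.num₀ x₀ ⟧₀ (u ∷ [])) x0)
             (solveℚ 2 (λ A B → Qℚ.num₀ A B (qc 0ℚ) q= qc 1ℚ) refl a b))

  lin-coeff0 : ∀ z → z 0 ≡ 0ℚ → linˢ z 0 ≡ ℚ.- 1ℚ
  lin-coeff0 z z0 = P.trans (⟦⟧-coeff0 (E.lin x₀) (z ∷ []))
    (P.trans (P.cong (λ u → ⟦ E.lin x₀ ⟧₀ (u ∷ [])) z0)
             (solveℚ 2 (λ A B → Qℚ.lin A B (qc 0ℚ) q= q- qc 1ℚ) refl a b))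

  R-coeff0 : ∀ x z → x 0 ≡ 0ℚ → z 0 ≡ 0ℚ → Rˢ x z 0 ≡ ℚ.- 1ℚ
  R-coeff0 x z x0 z0 = P.trans (⟦⟧-coeff0 (E.R x₀ x₁) (x ∷ z ∷ []))
    (P.trans (P.cong₂ (λ u v → ⟦ E.R x₀ x₁ ⟧₀ (u ∷ v ∷ [])) x0 z0)
             (solveℚ 2 (λ A B → Qℚ.R A B (qc 0ℚ) (qc 0ℚ) q= q- qc 1ℚ) refl a b))

  denG-coeff0 : ∀ x s → x 0 ≡ 0ℚ → s 0 ≡ 1ℚ → denGˢ x s 0 ≡ 2b
  denG-coeff0 x s x0 s0 = P.trans (⟦⟧-coeff0 (E.denG x₀ x₁) (x ∷ s ∷ []))
    (P.trans (P.cong₂ (λ u v → ⟦ E.denG x₀ x₁ ⟧₀ (u ∷ v ∷ [])) x0 s0)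
             (solveℚ 2 (λ A B → Qℚ.denG A B (qc 0ℚ) (qc 1ℚ) q= Qℚ.twoB A B) refl a b))

  numF-coeff0 : ∀ x s → x 0 ≡ 0ℚ → s 0 ≡ 1ℚ → numFˢ x s 0 ≡ 0ℚ
  numF-coeff0 x s x0 s0 = P.trans (⟦⟧-coeff0 (E.numF x₀ x₁) (x ∷ s ∷ []))
    (P.trans (P.cong₂ (λ u v → ⟦ E.numF x₀ x₁ ⟧₀ (u ∷ v ∷ [])) x0 s0)
             (solveℚ 2 (λ A B → Qℚ.numF A B (qc 0ℚ) (qc 1ℚ) q= qc 0ℚ) refl a b))

  lin-relation : ∀ x s f → (f QF.⊛ denGˢ x s) ≋ numFˢ x s → (s QF.⊛ linˢ f) ≋ Rˢ x f
  lin-relation x s f h = ≋t (S-lin s f x) (+-difference (Rˢ x f) h)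

  numF-relation : ∀ x s f → (s QF.⊛ linˢ f) ≋ Rˢ x f → (f QF.⊛ denGˢ x s) ≋ numFˢ x s
  numF-relation x s f h = x∙y⁻¹≈ε⇒x≈y _ _ (∙-cancelˡ (Rˢ x f) _ 0S
    (≋t (≋s (S-lin s f x)) (≋t h (≋s (PSQ.+-identityʳ (Rˢ x f))))))

  denG-lin-relation : ∀ x s f → (s QF.⊛ linˢ f) ≋ Rˢ x f → (denGˢ x s QF.⊛ linˢ f) ≋ (2B QF.⊛ linˢ x)
  denG-lin-relation x s f h =
    ≋t (denG-lin s f x) (+-vanishing _ (≋t (⊛ʳ a-1 (x≈y⇒x∙y⁻¹≈ε h)) (PSQ.zeroʳ a-1)))

  g-relation : b ≢ 0ℚ → ∀ x s f g → (s QF.⊛ linˢ f) ≋ Rˢ x f → (g QF.⊛ denGˢ x s) ≋ 2B →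
               (g QF.⊛ linˢ x) ≋ linˢ f
  g-relation b≢0 x s f g h hg = ⊛-cancelʳ (g QF.⊛ linˢ x) (linˢ f) 2B scaled 2B0≢0
    where
    open import Relation.Binary.Reasoning.Setoid PSQ.setoid
    2B0≢0 : 2B 0 ≢ 0ℚ
    2B0≢0 e = *-≢0 2ℚ b (λ ()) b≢0 (P.trans (P.sym 2B-coeff0) e)
    scaled : ((g QF.⊛ linˢ x) QF.⊛ 2B) ≋ (linˢ f QF.⊛ 2B)
    scaled = begin
      (g QF.⊛ linˢ x) QF.⊛ 2B         ≈⟨ PSQ.*-assoc g (linˢ x) 2B ⟩
      g QF.⊛ (linˢ x QF.⊛ 2B)         ≈⟨ ⊛ʳ g (PSQ.*-comm (linˢ x) 2B) ⟩
      g QF.⊛ (2B QF.⊛ linˢ x)         ≈⟨ ⊛ʳ g (≋s (denG-lin-relation x s f h)) ⟩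
      g QF.⊛ (denGˢ x s QF.⊛ linˢ f)  ≈⟨ PSQ.sym (PSQ.*-assoc g (denGˢ x s) (linˢ f)) ⟩
      (g QF.⊛ denGˢ x s) QF.⊛ linˢ f  ≈⟨ ⊛ˡ (linˢ f) hg ⟩
      2B QF.⊛ linˢ f                  ≈⟨ PSQ.*-comm 2B (linˢ f) ⟩
      linˢ f QF.⊛ 2B                  ∎

  Q-vanishes : ∀ x s f → (s QF.⊛ s) ≋ radˢ x → (s QF.⊛ linˢ f) ≋ Rˢ x f → Qˢ x f ≋ 0S
  Q-vanishes x s f hs h = x≈y⇒x∙y⁻¹≈ε (begin
    radˢ x QF.⊛ (linˢ f QF.⊛ linˢ f)            ≈⟨ ⊛ˡ (linˢ f QF.⊛ linˢ f) (≋s hs) ⟩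
    (s QF.⊛ s) QF.⊛ (linˢ f QF.⊛ linˢ f)        ≈⟨ ≋s (⊛-square s (linˢ f)) ⟩
    (s QF.⊛ linˢ f) QF.⊛ (s QF.⊛ linˢ f)        ≈⟨ PSQ.*-cong h h ⟩
    Rˢ x f QF.⊛ Rˢ x f                          ∎)
    where open import Relation.Binary.Reasoning.Setoid PSQ.setoid

open RationalSeries using (module QF; _≋_)

module RiordanPair (a b : ℚ) (b≢0 : b ≢ 0ℚ) (S g f : QF.PS) (S0 : S 0 ≡ 1ℚ)
  (hS : (S QF.⊛ S) ≋ Concrete.radˢ a b QF.X)
  (hg : (g QF.⊛ Concrete.denGˢ a b QF.X S) ≋ Concrete.2B a b)
  (hf : (f QF.⊛ Concrete.denGˢ a b QF.X S) ≋ Concrete.numFˢ a b QF.X S) where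

  open import Data.Nat using (suc)
  open import Data.Rational as ℚ using ()
  import Data.Rational.Properties as ℚP
  open import Relation.Binary.PropositionalEquality as P using (refl)
  open import Data.Vec using ([]; _∷_)
  open import Defs using (2ℚ)
  open RationalSeries
  open Concrete a b

  1S : QF.PS
  1S = QF.const 1ℚ

  2b≢0 : 2b ≢ 0ℚ
  2b≢0 = *-≢0 2ℚ b (λ ()) b≢0

  denG-X-coeff0 : denGˢ X S 0 ≡ 2b
  denG-X-coeff0 = denG-coeff0 X S refl S0

  -- constant terms: denG(x, S) and numF(x, S) start with 2b and 0
  f0≡0 : f 0 ≡ 0ℚ
  f0≡0 = *≡0⇒≡0 (f 0) 2b f₀2b≡0 2b≢0
    where
    f₀2b≡0 : f 0 ℚ.* 2b ≡ 0ℚ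
    f₀2b≡0 = P.trans (P.cong (f 0 ℚ.*_) (P.sym denG-X-coeff0))
               (P.trans (P.sym (QF.⊛-0 f (denGˢ X S))) (P.trans (hf 0) (numF-coeff0 X S refl S0)))

  g0≢0 : g 0 ≢ 0ℚ
  g0≢0 g0≡0 = 2b≢0 (begin
    2b                   ≡⟨ P.sym 2B-coeff0 ⟩
    2B 0                 ≡⟨ P.sym (hg 0) ⟩
    (g QF.⊛ denGˢ X S) 0 ≡⟨ QF.⊛-0 g (denGˢ X S) ⟩
    g 0 ℚ.* denGˢ X S 0  ≡⟨ P.cong (ℚ._* denGˢ X S 0) g0≡0 ⟩
    0ℚ ℚ.* denGˢ X S 0   ≡⟨ ℚP.*-zeroˡ (denGˢ X S 0) ⟩
    0ℚ                   ∎)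
    where open P.≡-Reasoning

  S-lin-f : (S QF.⊛ linˢ f) ≋ Rˢ X f
  S-lin-f = lin-relation X S f hf

  module Substituted (F : QF.PS) (F0 : F 0 ≡ 0ℚ) where
    open ExprSubstitution F F0 public

    Z : QF.PS
    Z = compose S

    substitute₁ : ∀ (e : Expr 1) → compose (⟦ e ⟧ (X ∷ [])) ≋ ⟦ e ⟧ (F ∷ [])
    substitute₁ e = ≋t (compose-⟦⟧ e (X ∷ [])) (⟦⟧-cong₁ e compose-X)

    substitute₂ : ∀ (e : Expr 2) → compose (⟦ e ⟧ (X ∷ S ∷ [])) ≋ ⟦ e ⟧ (F ∷ Z ∷ [])
    substitute₂ e = ≋t (compose-⟦⟧ e (X ∷ S ∷ [])) (⟦⟧-cong₂ e compose-X QF.≋-refl)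

    Z² : (Z QF.⊛ Z) ≋ radˢ F
    Z² = ≋t (≋s (compose-⊛ S S)) (≋t (compose-cong hS) (substitute₁ (E.rad x₀)))

    g∘F-equation : (compose g QF.⊛ denGˢ F Z) ≋ 2B
    g∘F-equation = ≋t (⊛ʳ (compose g) (≋s (substitute₂ (E.denG x₀ x₁))))
                      (≋t (≋s (compose-⊛ g (denGˢ X S))) (≋t (compose-cong hg) (compose-⟦⟧ E.twoB [])))

    f∘F-equation : (compose f QF.⊛ denGˢ F Z) ≋ numFˢ F Z
    f∘F-equation = ≋t (⊛ʳ (compose f) (≋s (substitute₂ (E.denG x₀ x₁))))
                      (≋t (≋s (compose-⊛ f (denGˢ X S))) (≋t (compose-cong hf) (substitute₂ (E.numF x₀ x₁))))

    compose-column : ∀ k → compose (g QF.⊛ (f QF.^ k)) ≋ (compose g QF.⊛ (compose f QF.^ k))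
    compose-column k = ≋t (compose-⊛ g (f QF.^ k)) (⊛ʳ (compose g) (compose-^ f k))

  -- x-side: substitution into F₀ = x / den.  Writing the first component
  -- of L as G₀ + y H with G₀ den = num₀ and H den = num₁, this shows
  --   G₀ g(F₀) = 1   and   G₀ f(F₀) + H = 0.

  module InverseOfDen (F₀ : QF.PS) (F₀0 : F₀ 0 ≡ 0ℚ) (hF₀ : (F₀ QF.⊛ denˢ X) ≋ X) where
    open Substituted F₀ F₀0 public

    D : QF.PS
    D = denˢ X

    D0 : D 0 ≡ 1ℚ
    D0 = den-coeff0 X refl

    -- S(x / den) = (1 - b x²) / den, as the square root with constant term 1
    Z-den : (Z QF.⊛ D) ≋ Vˢ X
    Z-den = sqrt-unique (Z QF.⊛ D) (Vˢ X) squares constant (λ e → 2≢0 (P.trans (P.sym (P.cong₂ ℚ._+_ V0 V0)) e))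
      where
      open import Relation.Binary.Reasoning.Setoid PSQ.setoid
      V0 : Vˢ X 0 ≡ 1ℚ
      V0 = V-coeff0 X refl
      2≢0 : 1ℚ ℚ.+ 1ℚ ≢ 0ℚ
      2≢0 ()
      squares : ((Z QF.⊛ D) QF.⊛ (Z QF.⊛ D)) ≋ (Vˢ X QF.⊛ Vˢ X)
      squares = begin
        (Z QF.⊛ D) QF.⊛ (Z QF.⊛ D)              ≈⟨ ⊛-square Z D ⟩
        (Z QF.⊛ Z) QF.⊛ (D QF.⊛ D)              ≈⟨ ⊛ˡ (D QF.⊛ D) Z² ⟩
        radˢ F₀ QF.⊛ (D QF.⊛ D)                 ≈⟨ rad-den² F₀ X ⟩
        ⟦ E.radDen x₀ x₁ ⟧ ((F₀ QF.⊛ D) ∷ X ∷ []) ≈⟨ ⟦⟧-cong₂ (E.radDen x₀ x₁) hF₀ (QF.≋-refl {X}) ⟩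
        ⟦ E.radDen x₀ x₁ ⟧ (X ∷ X ∷ [])         ≈⟨ radDen-at-x X ⟩
        Vˢ X QF.⊛ Vˢ X                          ∎
      constant : (Z QF.⊛ D) 0 ≡ Vˢ X 0
      constant = P.trans (QF.⊛-0 Z D) (P.trans (P.cong₂ ℚ._*_ S0 D0) (P.sym V0))

    denG-F₀ : (denGˢ F₀ Z QF.⊛ D) ≋ (2B QF.⊛ num₀ˢ X)
    denG-F₀ = ≋t (denG-den F₀ Z X) (≋t (⟦⟧-cong₃ (E.denGDen x₀ x₁ x₂) hF₀ Z-den (QF.≋-refl {X})) (denGDen-at-x X))

    numF-F₀ : ((numFˢ F₀ Z QF.⊛ D) QF.⊕ (2B QF.⊛ num₁ˢ X)) ≋ 0S
    numF-F₀ = ≋t (⊕ˡ (2B QF.⊛ num₁ˢ X) (≋t (numF-den F₀ Z X)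
                   (⟦⟧-cong₃ (E.numFDen x₀ x₁ x₂) hF₀ Z-den (QF.≋-refl {X}))))
                 (numFDen-at-x X)

    -- both identities are proved after multiplying by 2b den, which has
    -- constant term 2b ≠ 0
    q : QF.PS
    q = 2B QF.⊛ D

    q0≢0 : q 0 ≢ 0ℚ
    q0≢0 e = 2b≢0 (P.trans (P.sym (ℚP.*-identityʳ 2b))
                    (P.trans (P.sym (P.cong₂ ℚ._*_ 2B-coeff0 D0)) (P.trans (P.sym (QF.⊛-0 2B D)) e)))

    G₀-g∘F₀ : ∀ G₀ → (G₀ QF.⊛ D) ≋ num₀ˢ X → (G₀ QF.⊛ compose g) ≋ 1S
    G₀-g∘F₀ G₀ hG₀ = ⊛-cancelʳ (G₀ QF.⊛ compose g) 1S q times-q q0≢0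
      where
      open import Relation.Binary.Reasoning.Setoid PSQ.setoid
      regroup : ∀ G T D → ((G QF.⊛ T) QF.⊛ (2B QF.⊛ D)) ≋ (T QF.⊛ (2B QF.⊛ (G QF.⊛ D)))
      regroup G T D = solve 4 (λ G T D B → (G :* T) :* (B :* D) := T :* (B :* (G :* D))) PSQ.refl G T D 2B
      times-q : ((G₀ QF.⊛ compose g) QF.⊛ q) ≋ (1S QF.⊛ q)
      times-q = begin
        (G₀ QF.⊛ compose g) QF.⊛ q           ≈⟨ regroup G₀ (compose g) D ⟩
        compose g QF.⊛ (2B QF.⊛ (G₀ QF.⊛ D)) ≈⟨ ⊛ʳ (compose g) (⊛ʳ 2B hG₀) ⟩
        compose g QF.⊛ (2B QF.⊛ num₀ˢ X)     ≈⟨ ⊛ʳ (compose g) (≋s denG-F₀) ⟩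
        compose g QF.⊛ (denGˢ F₀ Z QF.⊛ D)   ≈⟨ ≋s (QF.⊛-assoc (compose g) (denGˢ F₀ Z) D) ⟩
        (compose g QF.⊛ denGˢ F₀ Z) QF.⊛ D   ≈⟨ ⊛ˡ D g∘F-equation ⟩
        q                                    ≈⟨ ≋s (QF.const1-⊛ q) ⟩
        1S QF.⊛ q                            ∎

    G₀-f∘F₀ : ∀ G₀ H → (G₀ QF.⊛ D) ≋ num₀ˢ X → (H QF.⊛ D) ≋ num₁ˢ X →
              ((G₀ QF.⊛ compose f) QF.⊕ H) ≋ 0S
    G₀-f∘F₀ G₀ H hG₀ hH = ⊛≋0⇒≋0 ((G₀ QF.⊛ compose f) QF.⊕ H) q times-q q0≢0
      where
      open import Relation.Binary.Reasoning.Setoid PSQ.setoid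
      regroup : ∀ G T H D → (((G QF.⊛ T) QF.⊕ H) QF.⊛ (2B QF.⊛ D)) ≋
                            ((T QF.⊛ (2B QF.⊛ (G QF.⊛ D))) QF.⊕ (2B QF.⊛ (H QF.⊛ D)))
      regroup G T H D = solve 5 (λ G T H D B →
        ((G :* T) :+ H) :* (B :* D) := (T :* (B :* (G :* D))) :+ (B :* (H :* D))) PSQ.refl G T H D 2B
      times-q : (((G₀ QF.⊛ compose f) QF.⊕ H) QF.⊛ q) ≋ 0S
      times-q = begin
        ((G₀ QF.⊛ compose f) QF.⊕ H) QF.⊛ q
          ≈⟨ regroup G₀ (compose f) H D ⟩
        (compose f QF.⊛ (2B QF.⊛ (G₀ QF.⊛ D))) QF.⊕ (2B QF.⊛ (H QF.⊛ D))
          ≈⟨ ⊕c (⊛ʳ (compose f) (⊛ʳ 2B hG₀)) (⊛ʳ 2B hH) ⟩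
        (compose f QF.⊛ (2B QF.⊛ num₀ˢ X)) QF.⊕ (2B QF.⊛ num₁ˢ X)
          ≈⟨ ⊕ˡ (2B QF.⊛ num₁ˢ X) (⊛ʳ (compose f) (≋s denG-F₀)) ⟩
        (compose f QF.⊛ (denGˢ F₀ Z QF.⊛ D)) QF.⊕ (2B QF.⊛ num₁ˢ X)
          ≈⟨ ⊕ˡ (2B QF.⊛ num₁ˢ X) (≋t (≋s (QF.⊛-assoc (compose f) (denGˢ F₀ Z) D)) (⊛ˡ D f∘F-equation)) ⟩
        (numFˢ F₀ Z QF.⊛ D) QF.⊕ (2B QF.⊛ num₁ˢ X)
          ≈⟨ numF-F₀ ⟩
        0S ∎

    -- consequently, coefficientwise in y:  G₀ (g fᵐ)(F₀) + H (g fᵐ⁻¹)(F₀)  is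
    -- 1 for m = 0 and 0 for m > 0
    column-0 : ∀ G₀ → (G₀ QF.⊛ D) ≋ num₀ˢ X → (G₀ QF.⊛ compose (g QF.⊛ (f QF.^ 0))) ≋ 1S
    column-0 G₀ hG₀ = ≋t (⊛ʳ G₀ (compose-cong (PSQ.*-identityʳ g))) (G₀-g∘F₀ G₀ hG₀)

    column-suc : ∀ G₀ H → (G₀ QF.⊛ D) ≋ num₀ˢ X → (H QF.⊛ D) ≋ num₁ˢ X → ∀ m →
      ((G₀ QF.⊛ compose (g QF.⊛ (f QF.^ suc m))) QF.⊕ (H QF.⊛ compose (g QF.⊛ (f QF.^ m)))) ≋ 0S
    column-suc G₀ H hG₀ hH m = begin
      (G₀ QF.⊛ compose (g QF.⊛ (f QF.^ suc m))) QF.⊕ (H QF.⊛ compose (g QF.⊛ (f QF.^ m)))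
        ≈⟨ ⊕c (⊛ʳ G₀ (compose-column (suc m))) (⊛ʳ H (compose-column m)) ⟩
      (G₀ QF.⊛ (g∘ QF.⊛ (f∘ QF.⊛ W))) QF.⊕ (H QF.⊛ (g∘ QF.⊛ W))
        ≈⟨ factor G₀ g∘ f∘ H W ⟩
      ((G₀ QF.⊛ f∘) QF.⊕ H) QF.⊛ (g∘ QF.⊛ W)
        ≈⟨ ≋t (⊛ˡ (g∘ QF.⊛ W) (G₀-f∘F₀ G₀ H hG₀ hH)) (PSQ.zeroˡ (g∘ QF.⊛ W)) ⟩
      0S ∎
      where
      open import Relation.Binary.Reasoning.Setoid PSQ.setoid
      g∘ = compose g
      f∘ = compose f
      W  = f∘ QF.^ m
      factor : ∀ G t u H W → ((G QF.⊛ (t QF.⊛ (u QF.⊛ W))) QF.⊕ (H QF.⊛ (t QF.⊛ W))) ≋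
                             (((G QF.⊛ u) QF.⊕ H) QF.⊛ (t QF.⊛ W))
      factor = solve 5 (λ G t u H W → (G :* (t :* (u :* W))) :+ (H :* (t :* W)) := ((G :* u) :+ H) :* (t :* W))
                 PSQ.refl

  -- The relation between x and f is
  -- symmetric (Q(x, f) = Q(f, x)), so S(f) lin x = R(f, x), whence
  -- f(f) = x and g(f) lin f = lin x; with g lin x = lin f this gives
  -- g g(f) = 1, i.e. (g, f)² = (g g(f), f(f)) = (1, x).

  module Self = Substituted f f0≡0

  lin-coeff0-X : linˢ X 0 ≡ ℚ.- 1ℚ
  lin-coeff0-X = lin-coeff0 X refl

  -- S(f) lin x and R(f, x) square to rad(f) lin x² (by Q(f, x) = 0) and
  -- both have constant term -1
  S∘f-lin : (Self.Z QF.⊛ linˢ X) ≋ Rˢ f X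
  S∘f-lin = sqrt-unique (Self.Z QF.⊛ linˢ X) (Rˢ f X) squares constant
              (λ e → -2≢0 (P.trans (P.sym (P.cong₂ ℚ._+_ R0 R0)) e))
    where
    R0 : Rˢ f X 0 ≡ ℚ.- 1ℚ
    R0 = R-coeff0 f X f0≡0 refl
    -2≢0 : (ℚ.- 1ℚ) ℚ.+ (ℚ.- 1ℚ) ≢ 0ℚ
    -2≢0 ()
    open import Relation.Binary.Reasoning.Setoid PSQ.setoid
    Q-f-x : Qˢ f X ≋ 0S
    Q-f-x = ≋t (Q-symmetric X f) (Q-vanishes X S f hS S-lin-f)
    squares : ((Self.Z QF.⊛ linˢ X) QF.⊛ (Self.Z QF.⊛ linˢ X)) ≋ (Rˢ f X QF.⊛ Rˢ f X)
    squares = begin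
      (Self.Z QF.⊛ linˢ X) QF.⊛ (Self.Z QF.⊛ linˢ X) ≈⟨ ⊛-square Self.Z (linˢ X) ⟩
      (Self.Z QF.⊛ Self.Z) QF.⊛ (linˢ X QF.⊛ linˢ X) ≈⟨ ⊛ˡ (linˢ X QF.⊛ linˢ X) Self.Z² ⟩
      radˢ f QF.⊛ (linˢ X QF.⊛ linˢ X)             ≈⟨ x∙y⁻¹≈ε⇒x≈y _ _ Q-f-x ⟩
      Rˢ f X QF.⊛ Rˢ f X                            ∎
    constant : (Self.Z QF.⊛ linˢ X) 0 ≡ Rˢ f X 0
    constant = P.trans (QF.⊛-0 Self.Z (linˢ X))
                 (P.trans (P.cong₂ ℚ._*_ S0 lin-coeff0-X) (P.sym R0))

  -- f(f) and x both solve  h denG(f, S(f)) = numF(f, S(f))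
  f∘f : Self.compose f ≋ X
  f∘f = ⊛-cancelʳ (Self.compose f) X (denGˢ f Self.Z)
          (≋t Self.f∘F-equation (≋s (numF-relation f Self.Z X S∘f-lin)))
          (λ e → 2b≢0 (P.trans (P.sym (denG-coeff0 f Self.Z f0≡0 S0)) e))

  -- g lin x = lin f  and  g(f) lin f = lin x
  g-g∘f : (g QF.⊛ Self.compose g) ≋ 1S
  g-g∘f = ⊛-cancelʳ (g QF.⊛ Self.compose g) 1S (linˢ X QF.⊛ linˢ f) times-lin lin²0≢0
    where
    open import Relation.Binary.Reasoning.Setoid PSQ.setoid
    g∘ = Self.compose g
    g-lin : (g QF.⊛ linˢ X) ≋ linˢ f
    g-lin = g-relation b≢0 X S f g S-lin-f hg
    g∘f-lin : (g∘ QF.⊛ linˢ f) ≋ linˢ X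
    g∘f-lin = g-relation b≢0 f Self.Z X g∘ S∘f-lin Self.g∘F-equation
    regroup : ∀ g t d e → ((g QF.⊛ t) QF.⊛ (d QF.⊛ e)) ≋ ((g QF.⊛ d) QF.⊛ (t QF.⊛ e))
    regroup = solve 4 (λ g t d e → (g :* t) :* (d :* e) := (g :* d) :* (t :* e)) PSQ.refl
    times-lin : ((g QF.⊛ g∘) QF.⊛ (linˢ X QF.⊛ linˢ f)) ≋ (1S QF.⊛ (linˢ X QF.⊛ linˢ f))
    times-lin = begin
      (g QF.⊛ g∘) QF.⊛ (linˢ X QF.⊛ linˢ f)       ≈⟨ regroup g g∘ (linˢ X) (linˢ f) ⟩
      (g QF.⊛ linˢ X) QF.⊛ (g∘ QF.⊛ linˢ f)       ≈⟨ PSQ.*-cong g-lin g∘f-lin ⟩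
      linˢ f QF.⊛ linˢ X                          ≈⟨ PSQ.*-comm (linˢ f) (linˢ X) ⟩
      linˢ X QF.⊛ linˢ f                          ≈⟨ ≋s (QF.const1-⊛ _) ⟩
      1S QF.⊛ (linˢ X QF.⊛ linˢ f)                ∎
    lin²0≢0 : (linˢ X QF.⊛ linˢ f) 0 ≢ 0ℚ
    lin²0≢0 e = *-≢0 (ℚ.- 1ℚ) (ℚ.- 1ℚ) (λ ()) (λ ())
      (P.trans (P.sym (P.cong₂ ℚ._*_ lin-coeff0-X (lin-coeff0 f f0≡0)))
               (P.trans (P.sym (QF.⊛-0 (linˢ X) (linˢ f))) e))

  -- the coefficient of x in f(f) is (f 1)², and it equals 1
  f1≢0 : f 1 ≢ 0ℚ
  f1≢0 f1≡0 = 1≢0 (begin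
    1ℚ                     ≡⟨ P.sym (f∘f 1) ⟩
    Self.compose f 1       ≡⟨ coefficient-1 ⟩
    f 1 ℚ.* f 1            ≡⟨ P.cong (λ z → z ℚ.* z) f1≡0 ⟩
    0ℚ ℚ.* 0ℚ              ≡⟨ ℚP.*-zeroˡ 0ℚ ⟩
    0ℚ                     ∎)
    where
    open P.≡-Reasoning
    1≢0 : 1ℚ ≢ 0ℚ
    1≢0 ()
    -- the Horner form of f(f), read at x¹
    coefficient-1 : Self.compose f 1 ≡ f 1 ℚ.* f 1
    coefficient-1 = P.trans (P.cong (λ z → 0ℚ ℚ.+ ((0ℚ ℚ.+ z ℚ.* 0ℚ) ℚ.+ f 1 ℚ.* f 1)) f0≡0)
      (solveℚ 1 (λ y → qc 0ℚ q+ ((qc 0ℚ q+ qc 0ℚ q* qc 0ℚ) q+ y q* y) q= y q* y) refl (f 1))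

  -- (g, f) (g, f) = (g g(f), f(f)) = (1, x) = I
  involution : ∀ n k → QF.lowerMul (QF.riordan g f) (QF.riordan g f) n k ≡ QF.δ n k
  involution n k = begin
    QF.lowerMul (QF.riordan g f) (QF.riordan g f) n k
      ≡⟨ Self.riordan-act g (g QF.⊛ (f QF.^ k)) n ⟩
    (g QF.⊛ Self.compose (g QF.⊛ (f QF.^ k))) n
      ≡⟨ ⊛ʳ g (≋t (Self.compose-column k) (⊛ʳ (Self.compose g) (QF.^-cong k f∘f))) n ⟩
    (g QF.⊛ (Self.compose g QF.⊛ (X QF.^ k))) n
      ≡⟨ P.sym (QF.⊛-assoc g (Self.compose g) (X QF.^ k) n) ⟩
    ((g QF.⊛ Self.compose g) QF.⊛ (X QF.^ k)) n
      ≡⟨ ≋t (⊛ˡ (X QF.^ k) g-g∘f) (QF.const1-⊛ (X QF.^ k)) n ⟩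
    (X QF.^ k) n
      ≡⟨ QF.X^-coeff k n ⟩
    QF.δ n k ∎
    where open P.≡-Reasoning

open import Defs using (module XY; _≐₂_; denL; numL; xL; 2ℚ)

module Bivariate where
  open import Data.Nat as ℕ using (ℕ; zero; suc; _∸_; _<_)
  import Data.Nat.Properties as ℕP
  open import Data.Rational as ℚ using ()
  import Data.Rational.Properties as ℚP
  open import Relation.Binary.PropositionalEquality as P using (refl)
  open import Data.Sum using (inj₁; inj₂)
  open RationalSeries

  slice : XY.PS → ℕ → QF.PS
  slice A m n = A n m

  lift : QF.PS → XY.PS
  lift s n = QF.const (s n)

  slice-⊛ : ∀ (A B′ : XY.PS) (B : QF.PS) → (∀ n → B′ n ≋ QF.const (B n)) →
            ∀ m → slice (A XY.⊛ B′) m ≋ (slice A m QF.⊛ B)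
  slice-⊛ A B′ B h m n = P.trans (QF.sum-coeff (λ i → A i QF.⊛ B′ (n ∸ i)) (suc n) m)
    (QF.sum-cong′ (suc n) λ i → P.trans (⊛ʳ (A i) (h (n ∸ i)) m)
      (P.trans (QF.⊛-comm (A i) (QF.const (B (n ∸ i))) m)
        (P.trans (QF.const-⊛ (B (n ∸ i)) (A i) m) (ℚP.*-comm (B (n ∸ i)) (A i m)))))

  lift-⊛ : ∀ s t → (lift s XY.⊛ lift t) ≐₂ lift (s QF.⊛ t)
  lift-⊛ s t n m = P.trans (QF.sum-coeff (λ i → lift s i QF.⊛ lift t (n ∸ i)) (suc n) m)
    (P.trans (QF.sum-cong′ (suc n) (λ i → QF.const-* (s i) (t (n ∸ i)) m)) (coeff m))
    where
    coeff : ∀ m → QF.sumTo (λ i → QF.const (s i ℚ.* t (n ∸ i)) m) (suc n) ≡ lift (s QF.⊛ t) n m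
    coeff zero    = refl
    coeff (suc m) = QF.sum-zero (suc n) (λ i _ → refl)

  ⊛-linear : ∀ (p w : QF.PS) → (∀ l → p (suc (suc l)) ≡ 0ℚ) → ∀ m →
             (p QF.⊛ w) (suc m) ≡ p 0 ℚ.* w (suc m) ℚ.+ p 1 ℚ.* w m
  ⊛-linear p w h m = P.trans (QF.⊛-suc p w m) (P.cong (p 0 ℚ.* w (suc m) ℚ.+_)
    (P.trans (QF.sum-head _ m) (P.trans (P.cong (p 1 ℚ.* w m ℚ.+_)
       (QF.sum-zero m (λ i _ → P.trans (P.cong (ℚ._* w (m ∸ suc i)) (h i)) (ℚP.*-zeroˡ (w (m ∸ suc i))))))
       (ℚP.+-identityʳ _))))

  triangular-injective : ∀ (L : ℕ → ℕ → QF.PS) (d : ℕ → QF.PS) → (∀ j → L j j 0 ≢ 0ℚ) →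
    (∀ n → XF.sumTo (λ j → L n j QF.⊛ d j) (suc n) ≋ 0S) → ∀ j → d j ≋ 0S
  triangular-injective L d diag kernel j = below (suc j) j (ℕP.n<1+n j)
    where
    below : ∀ N j → j < N → d j ≋ 0S
    below (suc N) j j<sN with ℕP.m≤n⇒m<n∨m≡n (ℕP.≤-pred j<sN)
    ... | inj₁ j<N  = below N j j<N
    ... | inj₂ refl = ⊛≋0⇒≋0 (d j) (L j j) (≋t (QF.⊛-comm (d j) (L j j)) last) (diag j)
      where
      earlier : XF.sumTo (λ i → L j i QF.⊛ d i) j ≋ 0S
      earlier = XF.sum-zero j (λ i i<j → ≋t (⊛ʳ (L j i) (below j i i<j)) (PSQ.zeroʳ (L j i)))
      last : (L j j QF.⊛ d j) ≋ 0S
      last = ≋t (≋s (PSQ.+-identityˡ _)) (≋t (⊕ˡ (L j j QF.⊛ d j) (≋s earlier)) (kernel j))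

  triangular-unique : ∀ (L : ℕ → ℕ → QF.PS) (u v : ℕ → QF.PS) → (∀ j → L j j 0 ≢ 0ℚ) →
    (∀ n → XF.sumTo (λ j → L n j QF.⊛ u j) (suc n) ≋ XF.sumTo (λ j → L n j QF.⊛ v j) (suc n)) →
    ∀ j → u j ≋ v j
  triangular-unique L u v diag same j =
    x∙y⁻¹≈ε⇒x≈y (u j) (v j) (triangular-injective L (λ i → u i PSQ.- v i) diag kernel j)
    where
    distrib : ∀ p x y → (p QF.⊛ (x PSQ.- y)) ≋ ((p QF.⊛ x) PSQ.- (p QF.⊛ y))
    distrib = solve 3 (λ p x y → p :* (x :- y) := (p :* x) :- (p :* y)) PSQ.refl
    kernel : ∀ n → XF.sumTo (λ j → L n j QF.⊛ (u j PSQ.- v j)) (suc n) ≋ 0S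
    kernel n = ≋t (XF.sum-cong′ (suc n) (λ j → distrib (L n j) (u j) (v j)))
      (≋t (XF.sum-+ (λ j → L n j QF.⊛ u j) (λ j → QF.⊖ (L n j QF.⊛ v j)) (suc n))
      (≋t (⊕ʳ (XF.sumTo (λ j → L n j QF.⊛ u j) (suc n)) (XF.sum-neg (λ j → L n j QF.⊛ v j) (suc n)))
          (x≈y⇒x∙y⁻¹≈ε (same n))))

-- The array L = (G, F) of the theorem, read through its y-slices:
-- G = G₀ + y H with G₀ den = num₀ and H den = num₁, while F = F₀ = x / den
-- does not involve y.  So the entry L(n, j) = [xⁿ] G Fʲ has y-degree at
-- most one, with slices [xⁿ] G₀ F₀ʲ and [xⁿ] H F₀ʲ.
module ArrayL (a b : ℚ) (G F : XY.PS)
  (hG : (G XY.⊛ denL a b) ≐₂ numL a b) (hF : (F XY.⊛ denL a b) ≐₂ xL) where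
  open import Data.Nat using (ℕ; zero; suc)
  open import Data.Rational as ℚ using ()
  import Data.Rational.Properties as ℚP
  open import Relation.Binary.PropositionalEquality as P using (refl)
  open RationalSeries
  open Concrete a b
  open Bivariate

  L : ℕ → ℕ → QF.PS
  L = XY.riordan G F

  D : QF.PS
  D = denˢ X

  D0≢0 : D 0 ≢ 0ℚ
  D0≢0 e = 1≢0 (P.trans (P.sym (den-coeff0 X refl)) e)
    where
    1≢0 : 1ℚ ≢ 0ℚ
    1≢0 ()

  slice-equation : ∀ (A N : XY.PS) → (A XY.⊛ denL a b) ≐₂ N → ∀ m → (slice A m QF.⊛ D) ≋ slice N m
  slice-equation A N h m =
    ≋t (⊛ʳ (slice A m) denˢ-X) (≋t (≋s (slice-⊛ A (denL a b) denQ den-const m)) (λ n → h n m))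
    where
    den-const : ∀ n → denL a b n ≋ QF.const (denQ n)
    den-const n m = P.cong (λ z → z m) (denL-const n)

  G₀ H F₀ : QF.PS
  G₀ = slice G 0
  H  = slice G 1
  F₀ = slice F 0

  hG₀ : (G₀ QF.⊛ D) ≋ num₀ˢ X
  hG₀ = ≋t (slice-equation G (numL a b) hG 0) (≋t slice₀ (≋s num₀ˢ-X))
    where
    slice₀ : slice (numL a b) 0 ≋ quadratic 1ℚ (2ℚ ℚ.- a) (ℚ.- a ℚ.+ b ℚ.+ 1ℚ)
    slice₀ 0 = refl
    slice₀ 1 = ℚP.+-identityʳ _
    slice₀ 2 = ℚP.+-identityʳ _
    slice₀ (suc (suc (suc n))) = refl

  hH : (H QF.⊛ D) ≋ num₁ˢ X
  hH = ≋t (slice-equation G (numL a b) hG 1) (≋t slice₁ (≋s num₁ˢ-X))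
    where
    slice₁ : slice (numL a b) 1 ≋ quadratic 0ℚ 1ℚ 1ℚ
    slice₁ 0 = refl
    slice₁ 1 = ℚP.+-identityˡ _
    slice₁ 2 = ℚP.+-identityˡ _
    slice₁ (suc (suc (suc n))) = refl

  G-high : ∀ l → slice G (suc (suc l)) ≋ 0S
  G-high l = ⊛≋0⇒≋0 (slice G (suc (suc l))) D (≋t (slice-equation G (numL a b) hG (suc (suc l))) high) D0≢0
    where
    high : slice (numL a b) (suc (suc l)) ≋ 0S
    high 0 = refl
    high 1 = ℚP.+-identityˡ _
    high 2 = ℚP.+-identityˡ _
    high (suc (suc (suc n))) = refl

  hF₀ : (F₀ QF.⊛ D) ≋ X
  hF₀ = ≋t (slice-equation F xL hF 0) slice₀
    where
    slice₀ : slice xL 0 ≋ X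
    slice₀ 0 = refl
    slice₀ 1 = refl
    slice₀ (suc (suc n)) = refl

  F-high : ∀ l → slice F (suc l) ≋ 0S
  F-high l = ⊛≋0⇒≋0 (slice F (suc l)) D (≋t (slice-equation F xL hF (suc l)) high) D0≢0
    where
    high : slice xL (suc l) ≋ 0S
    high 0 = refl
    high 1 = refl
    high (suc (suc n)) = refl

  F₀0 : F₀ 0 ≡ 0ℚ
  F₀0 = P.trans (P.sym (ℚP.*-identityʳ (F₀ 0)))
          (P.trans (P.cong (F₀ 0 ℚ.*_) (P.sym (den-coeff0 X refl)))
            (P.trans (P.sym (QF.⊛-0 F₀ D)) (hF₀ 0)))

  F₀1 : F₀ 1 ≡ 1ℚ
  F₀1 = P.trans (P.sym coefficient-1) (hF₀ 1)
    where
    coefficient-1 : (F₀ QF.⊛ D) 1 ≡ F₀ 1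
    coefficient-1 = P.trans (P.cong₂ (λ u v → (0ℚ ℚ.+ u ℚ.* D 1) ℚ.+ F₀ 1 ℚ.* v) F₀0 (den-coeff0 X refl))
      (solveℚ 2 (λ y z → (qc 0ℚ q+ qc 0ℚ q* y) q+ z q* qc 1ℚ q= z) refl (D 1) (F₀ 1))

  G₀0 : G₀ 0 ≡ 1ℚ
  G₀0 = P.trans (P.sym (ℚP.*-identityʳ (G₀ 0)))
          (P.trans (P.cong (G₀ 0 ℚ.*_) (P.sym (den-coeff0 X refl)))
            (P.trans (P.sym (QF.⊛-0 G₀ D)) (P.trans (hG₀ 0) (num₀-coeff0 X refl))))

  F^-lift : ∀ j → (F XY.^ j) ≐₂ lift (F₀ QF.^ j)
  F^-lift zero    zero    m = refl
  F^-lift zero    (suc n) m = refl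
  F^-lift (suc j) = XF.≋-trans {F XY.⊛ (F XY.^ j)} {lift F₀ XY.⊛ lift (F₀ QF.^ j)} {lift (F₀ QF.^ suc j)}
    (XF.⊛-cong {F} {lift F₀} {F XY.^ j} {lift (F₀ QF.^ j)} F-lift (F^-lift j)) (lift-⊛ F₀ (F₀ QF.^ j))
    where
    F-lift : ∀ n → F n ≋ QF.const (F₀ n)
    F-lift n zero    = refl
    F-lift n (suc m) = P.trans (F-high m n) (0S-coeff n)

  L-slice : ∀ n j m → L n j m ≡ (slice G m QF.⊛ (F₀ QF.^ j)) n
  L-slice n j m = slice-⊛ G (F XY.^ j) (F₀ QF.^ j) (F^-lift j) m n

  module ∘F₀ = QF.Substitution F₀ F₀0

  L-high : ∀ n j l → L n j (suc (suc l)) ≡ 0ℚ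
  L-high n j l = P.trans (L-slice n j (suc (suc l)))
    (P.trans (⊛ˡ (F₀ QF.^ j) (G-high l) n) (P.trans (PSQ.zeroˡ (F₀ QF.^ j) n) (0S-coeff n)))

  -- the diagonal of L is G₀ 0 · (F₀ 1)ʲ = 1
  L-diag : ∀ j → L j j 0 ≢ 0ℚ
  L-diag j e = 1≢0 (P.trans (P.sym diagonal) (P.trans (P.sym (L-slice j j 0)) e))
    where
    1≢0 : 1ℚ ≢ 0ℚ
    1≢0 ()
    pw-1 : ∀ n → QF.pw 1ℚ n ≡ 1ℚ
    pw-1 zero    = refl
    pw-1 (suc n) = P.trans (ℚP.*-identityˡ _) (pw-1 n)
    diagonal : (G₀ QF.⊛ (F₀ QF.^ j)) j ≡ 1ℚ
    diagonal = P.trans (∘F₀.riordan-diag G₀ j)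
      (P.trans (P.cong₂ ℚ._*_ G₀0 (P.trans (P.cong (λ z → QF.pw z j) F₀1) (pw-1 j))) (ℚP.*-identityˡ 1ℚ))

  -- With (g, f) as in RiordanPair: L applied to the y-generating functions
  -- Σₖ m_{j,k} yᵏ of the rows of (g, f) gives the first unit vector, so
  -- these are the entries of the first column of L⁻¹.
  module FirstColumn (b≢0 : b ≢ 0ℚ) (S g f : QF.PS) (S0 : S 0 ≡ 1ℚ)
    (hS : (S QF.⊛ S) ≋ radˢ X) (hg : (g QF.⊛ denGˢ X S) ≋ 2B) (hf : (f QF.⊛ denGˢ X S) ≋ numFˢ X S) where
    open RiordanPair a b b≢0 S g f S0 hS hg hf
    open InverseOfDen F₀ F₀0 hF₀

    row : ℕ → QF.PS
    row j k = QF.riordan g f j k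

    unit : ℕ → ℕ → ℚ
    unit n zero    = 1S n
    unit n (suc m) = 0ℚ

    unit-coeff : ∀ n m → XY.δ n 0 m ≡ unit n m
    unit-coeff zero    zero    = refl
    unit-coeff zero    (suc m) = refl
    unit-coeff (suc n) zero    = refl
    unit-coeff (suc n) (suc m) = refl

    L-row : ∀ n → XF.sumTo (λ j → L n j QF.⊛ row j) (suc n) ≋ XY.δ n 0
    L-row n m = P.trans (QF.sum-coeff (λ j → L n j QF.⊛ row j) (suc n) m)
                        (P.trans (coeff m) (P.sym (unit-coeff n m)))
      where
      open P.≡-Reasoning
      coeff : ∀ m → QF.sumTo (λ j → (L n j QF.⊛ row j) m) (suc n) ≡ unit n m
      coeff zero = begin
        QF.sumTo (λ j → (L n j QF.⊛ row j) 0) (suc n)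
          ≡⟨ QF.sum-cong′ (suc n) (λ j → P.trans (QF.⊛-0 (L n j) (row j)) (P.cong (ℚ._* row j 0) (L-slice n j 0))) ⟩
        QF.sumTo (λ j → (G₀ QF.⊛ (F₀ QF.^ j)) n ℚ.* (g QF.⊛ (f QF.^ 0)) j) (suc n)
          ≡⟨ riordan-act G₀ (g QF.⊛ (f QF.^ 0)) n ⟩
        (G₀ QF.⊛ compose (g QF.⊛ (f QF.^ 0))) n
          ≡⟨ column-0 G₀ hG₀ n ⟩
        1S n ∎
      coeff (suc m) = begin
        QF.sumTo (λ j → (L n j QF.⊛ row j) (suc m)) (suc n)
          ≡⟨ QF.sum-cong′ (suc n) (λ j → P.trans (⊛-linear (L n j) (row j) (L-high n j) m)
               (P.cong₂ (λ u v → u ℚ.* row j (suc m) ℚ.+ v ℚ.* row j m) (L-slice n j 0) (L-slice n j 1))) ⟩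
        QF.sumTo (λ j → (G₀ QF.⊛ (F₀ QF.^ j)) n ℚ.* (g QF.⊛ (f QF.^ suc m)) j
                       ℚ.+ (H QF.⊛ (F₀ QF.^ j)) n ℚ.* (g QF.⊛ (f QF.^ m)) j) (suc n)
          ≡⟨ QF.sum-+ _ _ (suc n) ⟩
        QF.sumTo (λ j → (G₀ QF.⊛ (F₀ QF.^ j)) n ℚ.* (g QF.⊛ (f QF.^ suc m)) j) (suc n)
          ℚ.+ QF.sumTo (λ j → (H QF.⊛ (F₀ QF.^ j)) n ℚ.* (g QF.⊛ (f QF.^ m)) j) (suc n)
          ≡⟨ P.cong₂ ℚ._+_ (riordan-act G₀ (g QF.⊛ (f QF.^ suc m)) n) (riordan-act H (g QF.⊛ (f QF.^ m)) n) ⟩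
        (G₀ QF.⊛ compose (g QF.⊛ (f QF.^ suc m))) n ℚ.+ (H QF.⊛ compose (g QF.⊛ (f QF.^ m))) n
          ≡⟨ P.trans (column-suc G₀ H hG₀ hH m n) (0S-coeff n) ⟩
        0ℚ ∎

    first-column : (Linv : ℕ → ℕ → QF.PS) → (∀ n k → XY.lowerMul L Linv n k ≋ XY.δ n k) →
                   ∀ n k → Linv n 0 k ≡ QF.riordan g f n k
    first-column Linv hL n = triangular-unique L (λ j → Linv j 0) row L-diag
                               (λ n → ≋t (hL n 0) (≋s (L-row n))) n

open import Defs
open import Data.Nat using (ℕ)
open import Data.Rational using (ℚ; 0ℚ; 1ℚ; _*_)
open import Data.Product using (_×_; _,_)
open import Relation.Binary.PropositionalEquality using (_≡_; _≢_)
open RationalSeries using (module QF; _≋_; ≋t; ≋s; ⊛ʳ)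

mainTheorem6 : (a b : ℚ) → b ≢ 0ℚ →
    (G F : XY.PS) → (G XY.⊛ denL a b) ≐₂ numL a b → (F XY.⊛ denL a b) ≐₂ xL →
    (Linv : ℕ → ℕ → QS.PS) →
    (∀ n k → XY.lowerMul (XY.riordan G F) Linv n k ≐ XY.δ n k) →
    (S : QS.PS) → S 0 ≡ 1ℚ → (S QS.⊛ S) ≐ radicand a b →
    (g f : QS.PS) → (g QS.⊛ denG a b S) ≐ QS.const (2ℚ * b) →
    (f QS.⊛ denG a b S) ≐ numF a b S →
    ((g 0 ≢ 0ℚ × f 0 ≡ 0ℚ × f 1 ≢ 0ℚ)
    × (∀ n k → Linv n 0 k ≡ QS.riordan g f n k))
    × (∀ n k → QS.lowerMul (QS.riordan g f) (QS.riordan g f) n k ≡ QS.δ n k)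
mainTheorem6 a b b≢0 G F hG hF Linv hL S S0 hS g f hg hf =
  ((g0≢0 , f0≡0 , f1≢0) , first-column Linv hL) , involution
  where
  open Concrete a b
  hS′ : (S QF.⊛ S) ≋ radˢ X
  hS′ = ≋t hS radicand-X
  hg′ : (g QF.⊛ denGˢ X S) ≋ 2B
  hg′ = ≋t (⊛ʳ g (≋s (denG-shape S))) (≋t hg 2b-shape)
  hf′ : (f QF.⊛ denGˢ X S) ≋ numFˢ X S
  hf′ = ≋t (⊛ʳ f (≋s (denG-shape S))) (≋t hf (numF-shape S))
  open RiordanPair a b b≢0 S g f S0 hS′ hg′ hf′ using (g0≢0; f0≡0; f1≢0; involution)
  open ArrayL.FirstColumn a b G F hG hF b≢0 S g f S0 hS′ hg′ hf′ using (first-column)
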